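{- Let $r$ be an odd positive integer and let $G$ be an $r$-regular, nonbipartite, connected graph. Then $G$ has a spanning even tree, i.e., a spanning tree $T$ of $G$ in which every pair of leaves is joined by a path of even length.
   Context: All graphs are finite and contain no loops. A tree is called even if every pair of its vertices of degree one (leaves) is joined in the tree by a path of even length. A spanning tree of $G$ is a subgraph that is a tree with vertex set $V(G)$. -}

module Defs where

open import Data.Nat using (ℕ; zero; suc; _+_; _≥_)
open import Data.Nat.Properties using ()
open import Data.Bool using (Bool; true; false; T; _≟_)
open import Data.Fin using (Fin)
open import Data.List using (List; []; _∷_; length; filter; allFin; head; last)
open import Data.List.Relation.Unary.Unique.Propositional using (Unique)
open import Data.Maybe using (Maybe; just)
open import Data.Product using (Σ; _×_; _,_; ∃)
open import Data.Empty using (⊥)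
open import Relation.Nullary using (¬_)
open import Relation.Binary.PropositionalEquality using (_≡_; _≢_)
open import Relation.Nullary.Decidable using (⌊_⌋)

record Graph (n : ℕ) : Set where
  field
    adj  : Fin n → Fin n → Bool
    sym  : ∀ u v → adj u v ≡ adj v u
    loopless : ∀ v → adj v v ≡ false
open Graph public

Adj : ∀ {n} → Graph n → Fin n → Fin n → Set
Adj G u v = T (adj G u v)

degree : ∀ {n} → Graph n → Fin n → ℕ
degree {n} G v = length (filter (λ u → adj G v u ≟ true) (allFin n))

Regular : ∀ {n} → ℕ → Graph n → Set
Regular r G = ∀ v → degree G v ≡ r

IsWalk : ∀ {n} → Graph n → List (Fin n) → Set
IsWalk G [] = ⊥
IsWalk G (x ∷ []) = Data.Unit.⊤ where import Data.Unit
IsWalk G (x ∷ y ∷ xs) = Adj G x y × IsWalk G (y ∷ xs)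

WalkFromTo : ∀ {n} → Graph n → Fin n → Fin n → List (Fin n) → Set
WalkFromTo G u v xs = IsWalk G xs × head xs ≡ just u × last xs ≡ just v

-- path: walk with pairwise distinct vertices; its length = #edges = #vertices - 1
IsPath : ∀ {n} → Graph n → Fin n → Fin n → List (Fin n) → Set
IsPath G u v xs = WalkFromTo G u v xs × Unique xs

Connected : ∀ {n} → Graph n → Set
Connected {n} G = ∀ (u v : Fin n) → ∃ λ xs → WalkFromTo G u v xs

Bipartite : ∀ {n} → Graph n → Set
Bipartite {n} G = Σ (Fin n → Bool) λ c → ∀ u v → Adj G u v → c u ≢ c v

HasCycle : ∀ {n} → Graph n → Set
HasCycle {n} G = Σ (List (Fin n)) λ xs → Σ (Fin n) λ x → Σ (Fin n) λ y →
  length xs ≥ 3 × IsPath G x y xs × Adj G y x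

IsTree : ∀ {n} → Graph n → Set
IsTree G = Connected G × ¬ HasCycle G

Subgraph : ∀ {n} → Graph n → Graph n → Set
Subgraph H G = ∀ u v → Adj H u v → Adj G u v

SpanningTree : ∀ {n} → Graph n → Graph n → Set
SpanningTree G T' = Subgraph T' G × IsTree T'

Leaf : ∀ {n} → Graph n → Fin n → Set
Leaf G v = degree G v ≡ 1

data Even : ℕ → Set where
  even-zero : Even zero
  even-ss   : ∀ {k} → Even k → Even (suc (suc k))

-- even tree: every pair of leaves is joined by a path of even length
-- (path length = number of edges = number of listed vertices - 1;
-- in a tree the path between two vertices is unique)
EvenTree : ∀ {n} → Graph n → Set
EvenTree {n} T' = ∀ (u v : Fin n) → Leaf T' u → Leaf T' v →
  ∀ xs → IsPath T' u v xs → Even (length xs Data.Nat.∸ 1)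

Odd : ℕ → Set
Odd m = Even (suc m)

module Submission where

-- A tree is even exactly when all its leaves lie in one class of its 2-colouring. So we
-- choose an independent set B of G such that the bipartite graph H formed by the edges
-- between A = V ∖ B and B is connected, and find a spanning tree of H in which no vertex of B
-- is a leaf.
--
-- Regularity gives H surplus, |N(X)| > |X| for every nonempty X ⊆ B: X sends r|X| edges into
-- N(X), which receives at most r|N(X)|, and if |N(X)| ≤ |X| then N(X) has no neighbours
-- outside X, so by connectivity (X, N(X)) would bipartition G.
--
-- A connected bipartite graph with surplus has a spanning tree without leaves in B, by
-- induction on its size. If some nonempty X ⊊ B is tight, |N(X)| = |X| + 1, solve
-- H[X ∪ N(X)] and the graph with X ∪ N(X) contracted to one vertex of A, and glue the trees.
-- Otherwise, for a fixed b ∈ B, every nonempty Y ⊆ B ∖ {b} has |N(Y)| ≥ |Y| + 2; contract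
-- the star joining b to one neighbour in each component of H − b and to one more neighbour,
-- and glue again.
--
-- Trees are encoded by parent functions that strictly decrease a rank.


open import Defs hiding (sym)
open import Defs using () renaming (sym to gsym)
open import Data.Nat using (ℕ; zero; suc; _+_; _*_; _≤_; _<_; z≤n; s≤s; s≤s⁻¹; _≤?_; _≡ᵇ_)
open import Data.Nat.Properties
open import Data.Bool using (Bool; true; false; T; not; _∧_; _∨_; if_then_else_)
import Data.Bool as B
open import Data.Bool.Properties using (∨-comm; not-involutive; not-¬)
open import Data.Fin using (Fin; zero; suc)
import Data.Fin.Properties as FP
open import Data.Fin.Subset.Properties using (anySubset?)
open import Data.Vec using (Vec; lookup)
import Data.Vec as Vec
open import Data.Vec.Properties using (lookup∘tabulate)
open import Data.List using (List; []; _∷_; length; filter; head; last; _∷ʳ_)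
import Data.List as List
open import Data.List.Relation.Unary.Unique.Propositional using (Unique)
open import Data.List.Relation.Unary.Any using (here; there)
open import Data.List.Relation.Unary.AllPairs using ([]; _∷_)
open import Data.List.Relation.Unary.All using (All; []; _∷_)
import Data.List.Relation.Unary.All as All
open import Data.List.Membership.Propositional using (_∈_)
open import Data.Maybe using (Maybe; just; nothing; fromMaybe)
open import Data.Maybe.Properties using (just-injective)
import Data.Maybe
open import Data.Product using (Σ; _×_; _,_; proj₁; proj₂)
open import Data.Sum using (_⊎_; inj₁; inj₂; [_,_]′)
open import Data.Empty using (⊥; ⊥-elim)
open import Data.Unit using (⊤; tt)
open import Relation.Nullary using (¬_; yes; no)
open import Relation.Nullary.Decidable using (⌊_⌋; T?; toWitness; fromWitness)
open import Relation.Binary.PropositionalEquality hiding ([_])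
open import Function using (_∘_; id)

-- Finite Boolean predicates and counting

T∧ : ∀ {a b} → T a → T b → T (a ∧ b)
T∧ {true} {true} _ _ = tt

T∧₁ : ∀ {a b} → T (a ∧ b) → T a
T∧₁ {true} _ = tt

T∧₂ : ∀ {a b} → T (a ∧ b) → T b
T∧₂ {true} {true} _ = tt

T∨₁ : ∀ {a b} → T a → T (a ∨ b)
T∨₁ {true} _ = tt

T∨₂ : ∀ {a b} → T b → T (a ∨ b)
T∨₂ {true} _ = tt
T∨₂ {false} t = t

T∨-elim : ∀ {a b} → T (a ∨ b) → T a ⊎ T b
T∨-elim {true} t = inj₁ tt
T∨-elim {false} t = inj₂ t

¬T⇒T-not : ∀ {a} → ¬ T a → T (not a)
¬T⇒T-not {true} f = f tt
¬T⇒T-not {false} _ = tt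

T-not⇒¬T : ∀ {a} → T (not a) → ¬ T a
T-not⇒¬T {true} () _
T-not⇒¬T {false} _ ()

T-or-T-not : ∀ a → T a ⊎ T (not a)
T-or-T-not true = inj₁ tt
T-or-T-not false = inj₂ tt

T⇒≡true : ∀ {a} → T a → a ≡ true
T⇒≡true {true} _ = refl

¬T⇒≡false : ∀ {a} → ¬ T a → a ≡ false
¬T⇒≡false {true} f = ⊥-elim (f tt)
¬T⇒≡false {false} _ = refl

eqF : ∀ {n} → Fin n → Fin n → Bool
eqF u v = ⌊ u FP.≟ v ⌋

eqF-sound : ∀ {n} {u v : Fin n} → T (eqF u v) → u ≡ v
eqF-sound = toWitness

eqF-refl : ∀ {n} (u : Fin n) → T (eqF u u)
eqF-refl u = fromWitness refl

eqF-no : ∀ {n} {u v : Fin n} → u ≢ v → eqF u v ≡ false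
eqF-no {u = u} {v} u≢v with u FP.≟ v
... | yes u≡v = ⊥-elim (u≢v u≡v)
... | no _ = refl

T-ext : ∀ {a b} → (T a → T b) → (T b → T a) → a ≡ b
T-ext {true} {true} f g = refl
T-ext {true} {false} f g = ⊥-elim (f tt)
T-ext {false} {true} f g = ⊥-elim (g tt)
T-ext {false} {false} f g = refl

any : ∀ {n} → (Fin n → Bool) → Bool
any {zero} P = false
any {suc n} P = P zero ∨ any (P ∘ suc)

all : ∀ {n} → (Fin n → Bool) → Bool
all {zero} P = true
all {suc n} P = P zero ∧ all (P ∘ suc)

count : ∀ {n} → (Fin n → Bool) → ℕ
count {zero} P = 0
count {suc n} P = (if P zero then 1 else 0) + count (P ∘ suc)

any-intro : ∀ {n} (P : Fin n → Bool) v → T (P v) → T (any P)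
any-intro P zero t = T∨₁ t
any-intro P (suc v) t = T∨₂ {P zero} (any-intro (P ∘ suc) v t)

any-elim : ∀ {n} (P : Fin n → Bool) → T (any P) → Σ (Fin n) λ v → T (P v)
any-elim {zero} P ()
any-elim {suc n} P t with T∨-elim {P zero} t
... | inj₁ t0 = zero , t0
... | inj₂ t1 with any-elim (P ∘ suc) t1
... | v , tv = suc v , tv

all-elim : ∀ {n} (P : Fin n → Bool) → T (all P) → ∀ v → T (P v)
all-elim P t zero = T∧₁ t
all-elim P t (suc v) = all-elim (P ∘ suc) (T∧₂ {P zero} t) v

all-intro : ∀ {n} (P : Fin n → Bool) → (∀ v → T (P v)) → T (all P)
all-intro {zero} P f = tt
all-intro {suc n} P f = T∧ (f zero) (all-intro (P ∘ suc) (f ∘ suc))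

any-cong : ∀ {n} (P Q : Fin n → Bool) → (∀ v → P v ≡ Q v) → any P ≡ any Q
any-cong {zero} P Q e = refl
any-cong {suc n} P Q e = cong₂ _∨_ (e zero) (any-cong (P ∘ suc) (Q ∘ suc) (e ∘ suc))

all-cong : ∀ {n} (P Q : Fin n → Bool) → (∀ v → P v ≡ Q v) → all P ≡ all Q
all-cong {zero} P Q e = refl
all-cong {suc n} P Q e = cong₂ _∧_ (e zero) (all-cong (P ∘ suc) (Q ∘ suc) (e ∘ suc))

count-cong : ∀ {n} (P Q : Fin n → Bool) → (∀ v → P v ≡ Q v) → count P ≡ count Q
count-cong {zero} P Q e = refl
count-cong {suc n} P Q e rewrite e zero = cong (_ +_) (count-cong (P ∘ suc) (Q ∘ suc) (e ∘ suc))

indicator-mono : ∀ a b → (T a → T b) → (if a then 1 else 0) ≤ (if b then 1 else 0)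
indicator-mono true true f = ≤-refl
indicator-mono true false f = ⊥-elim (f tt)
indicator-mono false b f = z≤n

count-mono : ∀ {n} (P Q : Fin n → Bool) → (∀ v → T (P v) → T (Q v)) → count P ≤ count Q
count-mono {zero} P Q f = z≤n
count-mono {suc n} P Q f = +-mono-≤ (indicator-mono (P zero) (Q zero) (f zero)) (count-mono (P ∘ suc) (Q ∘ suc) (f ∘ suc))

count-mono-< : ∀ {n} (P Q : Fin n → Bool) → (∀ v → T (P v) → T (Q v)) → ∀ w → T (Q w) → ¬ T (P w) → count P < count Q
count-mono-< {suc n} P Q f zero qw npw with P zero | Q zero
... | true | _ = ⊥-elim (npw tt)
... | false | false = ⊥-elim qw
... | false | true = s≤s (count-mono (P ∘ suc) (Q ∘ suc) (f ∘ suc))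
count-mono-< {suc n} P Q f (suc w) qw npw =
  +-mono-≤-< (indicator-mono (P zero) (Q zero) (f zero)) (count-mono-< (P ∘ suc) (Q ∘ suc) (f ∘ suc) w qw npw)

count-none : ∀ {n} (P : Fin n → Bool) → (∀ v → ¬ T (P v)) → count P ≡ 0
count-none {zero} P f = refl
count-none {suc n} P f with P zero | f zero
... | true | g = ⊥-elim (g tt)
... | false | _ = count-none (P ∘ suc) (f ∘ suc)

indicator-∨-∧ : ∀ a b → (if (a ∨ b) then 1 else 0) + (if (a ∧ b) then 1 else 0) ≡ (if a then 1 else 0) + (if b then 1 else 0)
indicator-∨-∧ true true = refl
indicator-∨-∧ true false = refl
indicator-∨-∧ false true = refl
indicator-∨-∧ false false = refl

count-∨-∧ : ∀ {n} (P Q : Fin n → Bool) → count (λ v → P v ∨ Q v) + count (λ v → P v ∧ Q v) ≡ count P + count Q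
count-∨-∧ {zero} P Q = refl
count-∨-∧ {suc n} P Q =
  let a = if (P zero ∨ Q zero) then 1 else 0
      b = if (P zero ∧ Q zero) then 1 else 0
      c = if P zero then 1 else 0
      d = if Q zero then 1 else 0
      x = count (λ v → P (suc v) ∨ Q (suc v))
      y = count (λ v → P (suc v) ∧ Q (suc v))
      z = count (P ∘ suc)
      w = count (Q ∘ suc)
      ih : x + y ≡ z + w
      ih = count-∨-∧ (P ∘ suc) (Q ∘ suc)
      e1 : a + b ≡ c + d
      e1 = indicator-∨-∧ (P zero) (Q zero)
  in begin
       (a + x) + (b + y) ≡⟨ +-assoc a x (b + y) ⟩
       a + (x + (b + y)) ≡⟨ cong (a +_) (sym (+-assoc x b y)) ⟩
       a + ((x + b) + y) ≡⟨ cong (λ t → a + (t + y)) (+-comm x b) ⟩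
       a + ((b + x) + y) ≡⟨ cong (a +_) (+-assoc b x y) ⟩
       a + (b + (x + y)) ≡⟨ sym (+-assoc a b (x + y)) ⟩
       (a + b) + (x + y) ≡⟨ cong₂ _+_ e1 ih ⟩
       (c + d) + (z + w) ≡⟨ +-assoc c d (z + w) ⟩
       c + (d + (z + w)) ≡⟨ cong (c +_) (sym (+-assoc d z w)) ⟩
       c + ((d + z) + w) ≡⟨ cong (λ t → c + (t + w)) (+-comm d z) ⟩
       c + ((z + d) + w) ≡⟨ cong (c +_) (+-assoc z d w) ⟩
       c + (z + (d + w)) ≡⟨ sym (+-assoc c z (d + w)) ⟩
       (c + z) + (d + w) ∎
  where open ≡-Reasoning

count-disjoint-∨ : ∀ {n} (P Q : Fin n → Bool) → (∀ v → T (P v) → T (Q v) → ⊥) → count (λ v → P v ∨ Q v) ≡ count P + count Q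
count-disjoint-∨ P Q d = trans (sym (+-identityʳ (count (λ v → P v ∨ Q v)))) (trans (cong (count (λ v → P v ∨ Q v) +_) (sym z0)) (count-∨-∧ P Q))
  where z0 : count (λ v → P v ∧ Q v) ≡ 0
        z0 = count-none _ (λ v t → d v (T∧₁ t) (T∧₂ {P v} t))

count-∨-≤ : ∀ {n} (P Q : Fin n → Bool) → count (λ v → P v ∨ Q v) ≤ count P + count Q
count-∨-≤ P Q = ≤-trans (m≤m+n _ _) (≤-reflexive (count-∨-∧ P Q))

count-split : ∀ {n} (P Q : Fin n → Bool) → count P ≡ count (λ v → P v ∧ Q v) + count (λ v → P v ∧ not (Q v))
count-split P Q = trans (count-cong P _ e) (count-disjoint-∨ _ _ d)
  where e : ∀ v → P v ≡ ((P v ∧ Q v) ∨ (P v ∧ not (Q v)))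
        e v with P v | Q v
        ... | true | true = refl
        ... | true | false = refl
        ... | false | _ = refl
        d : ∀ v → T (P v ∧ Q v) → T (P v ∧ not (Q v)) → ⊥
        d v t1 t2 = T-not⇒¬T (T∧₂ {P v} t2) (T∧₂ {P v} t1)

count-singleton : ∀ {n} (x : Fin n) → count (λ v → eqF v x) ≡ 1
count-singleton {suc n} zero = trans (cong (1 +_) (count-none {n} (λ v → eqF (suc v) zero) (λ v t → 0≢suc v (eqF-sound t)))) refl
  where 0≢suc : ∀ {n} (v : Fin n) → Fin.suc v ≡ zero → ⊥
        0≢suc v ()
count-singleton {suc n} (suc x) rewrite eqF-no {u = zero {n}} {v = suc x} (λ ()) = trans (count-cong _ _ e) (count-singleton x)
  where e : ∀ v → eqF {suc n} (suc v) (suc x) ≡ eqF v x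
        e v = T-ext (λ t → ≡⇒eqF (FP.suc-injective (eqF-sound t))) (λ t → ≡⇒eqF (cong suc (eqF-sound t)))
          where ≡⇒eqF : ∀ {m} {a b : Fin m} → a ≡ b → T (eqF a b)
                ≡⇒eqF refl = eqF-refl _

count-≤2 : ∀ {n} (P : Fin n → Bool) (x y : Fin n) → (∀ v → T (P v) → v ≡ x ⊎ v ≡ y) → count P ≤ 2
count-≤2 P x y f = ≤-trans (count-mono P (λ v → eqF v x ∨ eqF v y) g)
                 (≤-trans (count-∨-≤ (λ v → eqF v x) (λ v → eqF v y)) (≤-reflexive (cong₂ _+_ (count-singleton x) (count-singleton y))))
  where g : ∀ v → T (P v) → T (eqF v x ∨ eqF v y)
        g v t with f v t
        ... | inj₁ refl = T∨₁ (eqF-refl v)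
        ... | inj₂ refl = T∨₂ {eqF v x} (eqF-refl v)

count-≥2 : ∀ {n} (P : Fin n → Bool) (x y : Fin n) → x ≢ y → T (P x) → T (P y) → 2 ≤ count P
count-≥2 P x y xy px py = ≤-trans (≤-reflexive (sym e)) (count-mono _ P g)
  where
    e : count (λ v → eqF v x ∨ eqF v y) ≡ 2
    e = trans (count-disjoint-∨ (λ v → eqF v x) (λ v → eqF v y) (λ v t1 t2 → xy (trans (sym (eqF-sound t1)) (eqF-sound t2))))
              (cong₂ _+_ (count-singleton x) (count-singleton y))
    g : ∀ v → T (eqF v x ∨ eqF v y) → T (P v)
    g v t with T∨-elim {eqF v x} t
    ... | inj₁ t1 rewrite eqF-sound t1 = px
    ... | inj₂ t2 rewrite eqF-sound t2 = py

first : ∀ {n} → (Fin n → Bool) → Maybe (Fin n)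
first {zero} P = nothing
first {suc n} P = if P zero then just zero else Data.Maybe.map suc (first (P ∘ suc))

pick : ∀ {n} → Fin n → (Fin n → Bool) → Fin n
pick d P = fromMaybe d (first P)

first-spec : ∀ {n} (P : Fin n → Bool) v → T (P v) → Σ (Fin n) λ w → first P ≡ just w × T (P w)
first-spec {suc n} P v t with P zero in eq
... | true = zero , refl , subst T (sym eq) tt
first-spec {suc n} P zero t | false = ⊥-elim (subst T eq t)
first-spec {suc n} P (suc v) t | false with first-spec (P ∘ suc) v t
... | w , e , tw rewrite e = suc w , refl , tw

pick-spec : ∀ {n} (d : Fin n) (P : Fin n → Bool) v → T (P v) → T (P (pick d P))
pick-spec d P v t with first-spec P v t
... | w , e , tw rewrite e = tw

first-cong : ∀ {n} (P Q : Fin n → Bool) → (∀ v → P v ≡ Q v) → first P ≡ first Q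
first-cong {zero} P Q e = refl
first-cong {suc n} P Q e rewrite e zero | first-cong (P ∘ suc) (Q ∘ suc) (e ∘ suc) = refl

pick-cong : ∀ {n} (d d' : Fin n) (P Q : Fin n → Bool) → (∀ v → P v ≡ Q v) → ∀ v → T (P v) → pick d P ≡ pick d' Q
pick-cong d d' P Q e v t with first-spec P v t
... | w , e1 , tw rewrite e1 | sym (first-cong P Q e) | e1 = refl

sum : ∀ {n} → (Fin n → ℕ) → ℕ
sum {zero} f = 0
sum {suc n} f = f zero + sum (f ∘ suc)

≤-sum : ∀ {n} (f : Fin n → ℕ) v → f v ≤ sum f
≤-sum f zero = m≤m+n _ _
≤-sum f (suc v) = ≤-trans (≤-sum (f ∘ suc) v) (m≤n+m _ (f zero))

if-t : ∀ {A : Set} {b : Bool} {x y : A} → T b → (if b then x else y) ≡ x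
if-t {b = true} _ = refl

if-f : ∀ {A : Set} {b : Bool} {x y : A} → ¬ T b → (if b then x else y) ≡ y
if-f {b = true} f = ⊥-elim (f tt)
if-f {b = false} _ = refl

count-pos⇒witness : ∀ {n} (P : Fin n → Bool) → 1 ≤ count P → Σ (Fin n) λ v → T (P v)
count-pos⇒witness {zero} P ()
count-pos⇒witness {suc n} P h with P zero in eq
... | true = zero , subst T (sym eq) tt
... | false with count-pos⇒witness (P ∘ suc) h
... | v , t = suc v , t

∃-subset? : ∀ {n} (P : (Fin n → Bool) → Bool) → (∀ C C' → (∀ v → C v ≡ C' v) → P C ≡ P C') →
         (Σ (Fin n → Bool) λ C → T (P C)) ⊎ (∀ C → ¬ T (P C))
∃-subset? {n} P ext with anySubset? {n = n} {P = λ s → T (P (lookup s))} (λ s → T? (P (lookup s)))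
... | yes (s , t) = inj₁ (lookup s , t)
... | no f = inj₂ (λ C t → f (Vec.tabulate C , subst T (ext C (lookup (Vec.tabulate C)) (λ v → sym (lookup∘tabulate C v))) t))

count-≥2⇒other : ∀ {n} (P : Fin n → Bool) → 2 ≤ count P → ∀ x → Σ (Fin n) λ y → T (P y) × y ≢ x
count-≥2⇒other P h x =
  let sp = count-split P (λ v → eqF v x)
      le1 : count (λ v → P v ∧ eqF v x) ≤ 1
      le1 = ≤-trans (count-mono _ (λ v → eqF v x) (λ v t → T∧₂ {P v} t)) (≤-reflexive (count-singleton x))
      h2 : 1 ≤ count (λ v → P v ∧ not (eqF v x))
      h2 = +-cancelˡ-≤ 1 _ _ (≤-trans h (≤-trans (≤-reflexive sp) (+-monoˡ-≤ _ le1)))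
      (y , ty) = count-pos⇒witness _ h2
  in y , T∧₁ ty , (λ e → T-not⇒¬T (T∧₂ {P y} ty) (subst (λ z → T (eqF y z)) e (eqF-refl y)))

eqB : Bool → Bool → Bool
eqB x y = (x ∧ y) ∨ (not x ∧ not y)

eqB-sound : ∀ {x y} → T (eqB x y) → x ≡ y
eqB-sound {true} {true} _ = refl
eqB-sound {false} {false} _ = refl
eqB-sound {true} {false} ()
eqB-sound {false} {true} ()

eqB-complete : ∀ {x y} → x ≡ y → T (eqB x y)
eqB-complete {true} refl = tt
eqB-complete {false} refl = tt

sum-cong : ∀ {n} (f g : Fin n → ℕ) → (∀ v → f v ≡ g v) → sum f ≡ sum g
sum-cong {zero} f g e = refl
sum-cong {suc n} f g e = cong₂ _+_ (e zero) (sum-cong (f ∘ suc) (g ∘ suc) (e ∘ suc))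

sum-mono : ∀ {n} (f g : Fin n → ℕ) → (∀ v → f v ≤ g v) → sum f ≤ sum g
sum-mono {zero} f g h = z≤n
sum-mono {suc n} f g h = +-mono-≤ (h zero) (sum-mono (f ∘ suc) (g ∘ suc) (h ∘ suc))

sum-mono-< : ∀ {n} (f g : Fin n → ℕ) → (∀ v → f v ≤ g v) → ∀ w → f w < g w → sum f < sum g
sum-mono-< {suc n} f g h zero lt = +-mono-<-≤ lt (sum-mono (f ∘ suc) (g ∘ suc) (h ∘ suc))
sum-mono-< {suc n} f g h (suc w) lt = +-mono-≤-< (h zero) (sum-mono-< (f ∘ suc) (g ∘ suc) (h ∘ suc) w lt)

sum-distrib-+ : ∀ {n} (f g : Fin n → ℕ) → sum (λ v → f v + g v) ≡ sum f + sum g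
sum-distrib-+ {zero} f g = refl
sum-distrib-+ {suc n} f g rewrite sum-distrib-+ (f ∘ suc) (g ∘ suc) = +-exchange
  where
    +-exchange : f zero + g zero + (sum (f ∘ suc) + sum (g ∘ suc)) ≡ f zero + sum (f ∘ suc) + (g zero + sum (g ∘ suc))
    +-exchange = trans (+-assoc (f zero) (g zero) _) (trans (cong (f zero +_) (trans (sym (+-assoc (g zero) _ _)) (trans (cong (_+ sum (g ∘ suc)) (+-comm (g zero) _)) (+-assoc (sum (f ∘ suc)) (g zero) (sum (g ∘ suc)))))) (sym (+-assoc (f zero) (sum (f ∘ suc)) _)))

sum-zeros : ∀ {n} → sum {n} (λ _ → 0) ≡ 0
sum-zeros {zero} = refl
sum-zeros {suc n} = sum-zeros {n}

sum-swap : ∀ {n m} (h : Fin n → Fin m → ℕ) → sum (λ a → sum (λ b → h a b)) ≡ sum (λ b → sum (λ a → h a b))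
sum-swap {zero} {m} h = sym (sum-zeros {m})
sum-swap {suc n} {m} h = trans (cong (sum (h zero) +_) (sum-swap (h ∘ suc))) (sym (sum-distrib-+ (λ b → h zero b) (λ b → sum (λ a → h (suc a) b))))

count≡sum-indicator : ∀ {n} (P : Fin n → Bool) → count P ≡ sum (λ v → if P v then 1 else 0)
count≡sum-indicator {zero} P = refl
count≡sum-indicator {suc n} P = cong ((if P zero then 1 else 0) +_) (count≡sum-indicator (P ∘ suc))

sum-indicator-scaled : ∀ {n} (P : Fin n → Bool) (r : ℕ) → sum (λ v → if P v then r else 0) ≡ r * count P
sum-indicator-scaled {zero} P r = sym (*-zeroʳ r)
sum-indicator-scaled {suc n} P r rewrite sum-indicator-scaled (P ∘ suc) r | *-distribˡ-+ r (if P zero then 1 else 0) (count (P ∘ suc)) with P zero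
... | true = cong (_+ r * count (P ∘ suc)) (sym (*-identityʳ r))
... | false = cong (_+ r * count (P ∘ suc)) (sym (*-zeroʳ r))

isRight : ∀ {A B : Set} → A ⊎ B → Bool
isRight (inj₁ _) = false
isRight (inj₂ _) = true

-- Walks

lastOr : ∀ {A : Set} → A → List A → A
lastOr x [] = x
lastOr x (y ∷ ys) = lastOr y ys

last≡ : ∀ {A : Set} (x : A) ys → last (x ∷ ys) ≡ just (lastOr x ys)
last≡ x [] = refl
last≡ x (y ∷ ys) = last≡ y ys

length-filter-tabulate : ∀ {n m} (f : Fin n → Bool) (g : Fin m → Fin n) →
  length (filter (λ u → f u B.≟ true) (List.tabulate g)) ≡ count (f ∘ g)
length-filter-tabulate {m = zero} f g = refl
length-filter-tabulate {m = suc m} f g with f (g zero)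
... | true = cong suc (length-filter-tabulate f (g ∘ suc))
... | false = length-filter-tabulate f (g ∘ suc)

degree≡count : ∀ {n} (G : Graph n) v → degree G v ≡ count (adj G v)
degree≡count G v = length-filter-tabulate (adj G v) id

module _ {n : ℕ} (G : Graph n) where

  RespectsEdges : (Fin n → Bool) → Set
  RespectsEdges C = ∀ u v → Adj G u v → C u ≡ C v

  walk-preserves : ∀ C → RespectsEdges C → ∀ x ys → IsWalk G (x ∷ ys) → C x ≡ C (lastOr x ys)
  walk-preserves C r x [] w = refl
  walk-preserves C r x (y ∷ ys) (a , w) = trans (r x y a) (walk-preserves C r y ys w)

  connected⇒constant : Connected G → ∀ C → RespectsEdges C → ∀ u v → C u ≡ C v
  connected⇒constant conn C r u v with conn u v
  ... | [] , () , _
  ... | x ∷ ys , w , h , l =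
    begin
      C u               ≡⟨ cong C (just-injective (sym h)) ⟩
      C x               ≡⟨ walk-preserves C r x ys w ⟩
      C (lastOr x ys)   ≡⟨ cong C (just-injective (trans (sym (last≡ x ys)) l)) ⟩
      C v               ∎
    where open ≡-Reasoning

-- Bipartite graphs with surplus have spanning trees without leaves in B

-- A bipartite graph with parts inA, inB ⊆ Fin n; E is only consulted between them.
record Bigraph (n : ℕ) : Set where
  constructor bigraph
  field inA inB : Fin n → Bool
        E : Fin n → Fin n → Bool
open Bigraph public

module _ {n : ℕ} where
  inV : Bigraph n → Fin n → Bool
  inV I v = inA I v ∨ inB I v

  Disjoint : Bigraph n → Set
  Disjoint I = ∀ v → T (inA I v) → T (inB I v) → ⊥

  Respects : Bigraph n → (Fin n → Bool) → Set
  Respects I C = ∀ a b → T (inA I a) → T (inB I b) → T (E I a b) → C a ≡ C b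

  IsConnected : Bigraph n → Set
  IsConnected I = ∀ (C : Fin n → Bool) → Respects I C → ∀ u v → T (inV I u) → T (inV I v) → C u ≡ C v

  nbhd : Bigraph n → (Fin n → Bool) → Fin n → Bool
  nbhd I X a = inA I a ∧ any (λ b → X b ∧ E I a b)

  SubsetOfB : Bigraph n → (Fin n → Bool) → Set
  SubsetOfB I X = ∀ v → T (X v) → T (inB I v)

  Surplus : Bigraph n → Set
  Surplus I = ∀ X → SubsetOfB I X → ∀ x → T (X x) → suc (count X) ≤ count (nbhd I X)

  size : Bigraph n → ℕ
  size I = count (inA I) + count (inB I)

  record ParentStep (I : Bigraph n) (p : Fin n → Fin n) (ρ : Fin n → ℕ) (v : Fin n) : Set where
    constructor parentStep
    field fromA : T (inA I v) → T (inB I (p v)) × T (E I v (p v))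
          fromB : T (inB I v) → T (inA I (p v)) × T (E I (p v) v)
          rank-< : ρ (p v) < ρ v

  -- A spanning tree of I rooted at r: parent edges join the two parts and decrease the rank ρ,
  -- and `child` says that no vertex of B is a leaf.
  record ParentTree (I : Bigraph n) (r : Fin n) : Set where
    constructor parentTree
    field p : Fin n → Fin n
          ρ : Fin n → ℕ
          step : ∀ v → T (inV I v) → v ≢ r → ParentStep I p ρ v
          child : ∀ b → T (inB I b) → Σ (Fin n) λ c → T (inV I c) × c ≢ r × p c ≡ b

  -- For K ⊆ A and Z ⊆ B, contract K ∪ Z to the vertex `as` ∈ K, which inherits all edges of K.
  contract : Bigraph n → (K Z : Fin n → Bool) → Fin n → Bigraph n
  contract I K Z as = bigraph (λ a → inA I a ∧ (not (K a) ∨ eqF a as)) (λ b → inB I b ∧ not (Z b))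
                       (λ a b → if eqF a as then any (λ k → K k ∧ E I k b) else E I a b)

  restrict : Bigraph n → (K Z : Fin n → Bool) → Bigraph n
  restrict I K Z = bigraph K Z (E I)

inV-elim : ∀ {n} (I : Bigraph n) v → T (inV I v) → T (inA I v) ⊎ T (inB I v)
inV-elim I v t = T∨-elim {inA I v} t

inA⇒inV : ∀ {n} (I : Bigraph n) v → T (inA I v) → T (inV I v)
inA⇒inV I v t = T∨₁ t

inB⇒inV : ∀ {n} (I : Bigraph n) v → T (inB I v) → T (inV I v)
inB⇒inV I v t = T∨₂ {inA I v} t

module Contraction {n : ℕ} (I : Bigraph n) (K Z : Fin n → Bool) (as : Fin n)
  (disj : Disjoint I) (KA : ∀ v → T (K v) → T (inA I v)) (ZB : ∀ v → T (Z v) → T (inB I v)) (Kas : T (K as)) where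

  I/KZ : Bigraph n
  I/KZ = contract I K Z as
  I↾KZ : Bigraph n
  I↾KZ = restrict I K Z

  KnB : ∀ v → T (K v) → ¬ T (inB I v)
  KnB v k = disj v (KA v k)
  ZnA : ∀ v → T (Z v) → ¬ T (inA I v)
  ZnA v z a = disj v a (ZB v z)

  A'A : ∀ v → T (inA I/KZ v) → T (inA I v)
  A'A v t = T∧₁ t
  B'B : ∀ v → T (inB I/KZ v) → T (inB I v)
  B'B v t = T∧₁ t
  B'nZ : ∀ v → T (inB I/KZ v) → ¬ T (Z v)
  B'nZ v t = T-not⇒¬T (T∧₂ {inB I v} t)
  A'nK : ∀ v → T (inA I/KZ v) → v ≢ as → ¬ T (K v)
  A'nK v t ne with T∨-elim {not (K v)} (T∧₂ {inA I v} t)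
  ... | inj₁ x = T-not⇒¬T x
  ... | inj₂ y = ⊥-elim (ne (eqF-sound y))
  E'as : ∀ b → T (E I/KZ as b) → T (any (λ k → K k ∧ E I k b))
  E'as b t rewrite if-t {b = eqF as as} {x = any (λ k → K k ∧ E I k b)} {y = E I as b} (eqF-refl as) = t
  E'o : ∀ a b → a ≢ as → T (E I/KZ a b) → T (E I a b)
  E'o a b ne t rewrite if-f {b = eqF a as} {x = any (λ k → K k ∧ E I k b)} {y = E I a b} (λ e → ne (eqF-sound e)) = t
  Aas' : T (inA I/KZ as)
  Aas' = T∧ (KA as Kas) (T∨₂ {not (K as)} (eqF-refl as))
  nK→A' : ∀ v → T (inA I v) → ¬ T (K v) → T (inA I/KZ v)
  nK→A' v a nk = T∧ a (T∨₁ (¬T⇒T-not nk))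
  nZ→B' : ∀ v → T (inB I v) → ¬ T (Z v) → T (inB I/KZ v)
  nZ→B' v b nz = T∧ b (¬T⇒T-not nz)

  KZ : Fin n → Bool
  KZ v = K v ∨ Z v

  outKZ : ∀ w → T (inV I/KZ w) → w ≢ as → ¬ T (KZ w)
  outKZ w t ne kz with inV-elim I/KZ w t | T∨-elim {K w} kz
  ... | inj₁ a | inj₁ k = A'nK w a ne k
  ... | inj₁ a | inj₂ z = ZnA w z (A'A w a)
  ... | inj₂ b | inj₁ k = KnB w k (B'B w b)
  ... | inj₂ b | inj₂ z = B'nZ w b z

  notKZ→I' : ∀ v → T (inV I v) → ¬ T (KZ v) → T (inV I/KZ v)
  notKZ→I' v t nkz with inV-elim I v t
  ... | inj₁ a = inA⇒inV I/KZ v (nK→A' v a (λ k → nkz (T∨₁ k)))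
  ... | inj₂ b = inB⇒inV I/KZ v (nZ→B' v b (λ z → nkz (T∨₂ {K v} z)))

  -- The glued tree follows the inner tree on K ∪ Z and the outer one elsewhere, hanging a child of `as`
  -- below a vertex of K adjacent to it. Ranks compare outer rank first: scale * ρ' + ρJ with ρJ < scale.
  -- `mode`: either a0 ∈ K roots the inner tree and the outer one is rooted at `as`, or a0 roots the outer
  -- tree and the inner one is rooted at a vertex k0 ∈ K adjacent to the outer parent of `as`.
  module Glue (r' : Fin n) (S' : ParentTree I/KZ r') (k0 : Fin n) (SJ : ParentTree I↾KZ k0) (Kk0 : T (K k0))
             (a0 : Fin n) (Aa0 : T (inA I a0))
             (mode : (T (K a0) × k0 ≡ a0 × r' ≡ as) ⊎ (¬ T (K a0) × r' ≡ a0 × T (E I k0 (ParentTree.p S' as)))) where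
    open ParentTree S' renaming (p to p'; ρ to ρ'; step to step'; child to child')
    open ParentTree SJ renaming (p to pJ; ρ to ρJ; step to stepJ; child to childJ)

    Placement : Set
    Placement = (T (K a0) × k0 ≡ a0 × r' ≡ as) ⊎ (¬ T (K a0) × r' ≡ a0 × T (E I k0 (p' as)))

    scale : ℕ
    scale = suc (sum ρJ)

    parent : Fin n → Fin n
    parent v = if KZ v then (if eqF v k0 then p' as else pJ v)
           else (if eqF (p' v) as then pick a0 (λ k → K k ∧ E I k v) else p' v)
    rank : Fin n → ℕ
    rank v = if KZ v then scale * ρ' as + ρJ v else scale * ρ' v

    parent-inside : ∀ v → T (KZ v) → v ≢ k0 → parent v ≡ pJ v
    parent-inside v t ne = trans (if-t {b = KZ v} t) (if-f {b = eqF v k0} (λ e → ne (eqF-sound e)))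
    parent-k0 : parent k0 ≡ p' as
    parent-k0 = trans (if-t {b = KZ k0} (T∨₁ Kk0)) (if-t {b = eqF k0 k0} (eqF-refl k0))
    parent-redirected : ∀ v → ¬ T (KZ v) → p' v ≡ as → parent v ≡ pick a0 (λ k → K k ∧ E I k v)
    parent-redirected v t e = trans (if-f {b = KZ v} t) (if-t {b = eqF (p' v) as} (≡⇒eqF e))
      where ≡⇒eqF : p' v ≡ as → T (eqF (p' v) as)
            ≡⇒eqF e rewrite e = eqF-refl as
    parent-outside : ∀ v → ¬ T (KZ v) → p' v ≢ as → parent v ≡ p' v
    parent-outside v t ne = trans (if-f {b = KZ v} t) (if-f {b = eqF (p' v) as} (λ e → ne (eqF-sound e)))
    rank-inside : ∀ v → T (KZ v) → rank v ≡ scale * ρ' as + ρJ v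
    rank-inside v t = if-t {b = KZ v} t
    rank-outside : ∀ v → ¬ T (KZ v) → rank v ≡ scale * ρ' v
    rank-outside v t = if-f {b = KZ v} t

    stepVia : ∀ v w → parent v ≡ w → (T (inA I v) → T (inB I w) × T (E I v w)) → (T (inB I v) → T (inA I w) × T (E I w v)) → rank w < rank v → ParentStep I parent rank v
    stepVia v w e f g h = parentStep (λ a → subst (λ x → T (inB I x) × T (E I v x)) (sym e) (f a)) (λ b → subst (λ x → T (inA I x) × T (E I x v)) (sym e) (g b)) (subst (λ x → rank x < rank v) (sym e) h)

    ρJ<scale : ∀ v → ρJ v < scale
    ρJ<scale v = s≤s (≤-sum ρJ v)

    step-k0 : k0 ≢ a0 → ParentStep I parent rank k0
    step-k0 ne = proof mode
      where
        proof : Placement → ParentStep I parent rank k0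
        proof (inj₁ (_ , e , _)) = ⊥-elim (ne e)
        proof (inj₂ (nKa0 , er' , Ek0)) =
          let nr : as ≢ r'
              nr e = nKa0 (subst (λ x → T (K x)) (trans e er') Kas)
              P = step' as (inA⇒inV I/KZ as Aas') nr
              c = p' as
              cB' = proj₁ (ParentStep.fromA P Aas')
              cnKZ : ¬ T (KZ c)
              cnKZ = outKZ c (inB⇒inV I/KZ c cB') (λ e → KnB as Kas (subst (λ x → T (inB I x)) e (B'B c cB')))
          in stepVia k0 c parent-k0 (λ _ → B'B c cB' , Ek0) (λ b → ⊥-elim (KnB k0 Kk0 b))
                (subst₂ _<_ (sym (rank-outside c cnKZ)) (sym (rank-inside k0 (T∨₁ Kk0)))
                  (≤-trans (*-monoʳ-< scale (ParentStep.rank-< P)) (m≤m+n (scale * ρ' as) (ρJ k0))))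

    step-inside : ∀ v → T (KZ v) → v ≢ k0 → ParentStep I parent rank v
    step-inside v kz nk0 =
      let PJ = stepJ v kz nk0
          w = pJ v
          wKZ : T (KZ w)
          wKZ = wKZf (T∨-elim {K v} kz)
      in stepVia v w (parent-inside v kz nk0)
           (λ a → case-A a)
           (λ b → case-B b)
           (subst₂ _<_ (sym (rank-inside w wKZ)) (sym (rank-inside v kz)) (+-monoʳ-< (scale * ρ' as) (ParentStep.rank-< PJ)))
      where
        wKZf : T (K v) ⊎ T (Z v) → T (KZ (pJ v))
        wKZf (inj₁ k) = T∨₂ {K (pJ v)} (proj₁ (ParentStep.fromA (stepJ v kz nk0) k))
        wKZf (inj₂ z) = T∨₁ (proj₁ (ParentStep.fromB (stepJ v kz nk0) z))
        case-A : T (inA I v) → T (inB I (pJ v)) × T (E I v (pJ v))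
        case-A a with T∨-elim {K v} kz
        ... | inj₁ k = let q = ParentStep.fromA (stepJ v kz nk0) k in ZB _ (proj₁ q) , proj₂ q
        ... | inj₂ z = ⊥-elim (ZnA v z a)
        case-B : T (inB I v) → T (inA I (pJ v)) × T (E I (pJ v) v)
        case-B b with T∨-elim {K v} kz
        ... | inj₁ k = ⊥-elim (KnB v k b)
        ... | inj₂ z = let q = ParentStep.fromB (stepJ v kz nk0) z in KA _ (proj₁ q) , proj₂ q

    r'-ne : ∀ v → ¬ T (KZ v) → v ≢ a0 → v ≢ r'
    r'-ne v nkz ne e = aux mode
      where aux : Placement → ⊥
            aux (inj₁ (_ , _ , er')) = nkz (T∨₁ (subst (λ x → T (K x)) (sym (trans e er')) Kas))
            aux (inj₂ (_ , er' , _)) = ne (trans e er')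

    step-outside : ∀ v → T (inV I v) → ¬ T (KZ v) → v ≢ a0 → ParentStep I parent rank v
    step-outside v iv nkz ne with inV-elim I v iv
    ... | inj₁ a =
      let P = step' v (notKZ→I' v iv nkz) (r'-ne v nkz ne)
          vA' = nK→A' v a (λ k → nkz (T∨₁ k))
          w = p' v
          wB' = proj₁ (ParentStep.fromA P vA')
          wne : w ≢ as
          wne e = KnB as Kas (subst (λ x → T (inB I x)) e (B'B w wB'))
          wnkz = outKZ w (inB⇒inV I/KZ w wB') wne
          vne : v ≢ as
          vne e = nkz (T∨₁ (subst (λ x → T (K x)) (sym e) Kas))
      in stepVia v w (parent-outside v nkz wne) (λ _ → B'B w wB' , E'o v w vne (proj₂ (ParentStep.fromA P vA')))
            (λ b → ⊥-elim (disj v a b))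
            (subst₂ _<_ (sym (rank-outside w wnkz)) (sym (rank-outside v nkz)) (*-monoʳ-< scale (ParentStep.rank-< P)))
    ... | inj₂ b =
      let P = step' v (notKZ→I' v iv nkz) (r'-ne v nkz ne)
          vB' = nZ→B' v b (λ z → nkz (T∨₂ {K v} z))
          w = p' v
          wA' = proj₁ (ParentStep.fromB P vB')
      in step-outside-B P vB' wA' (T-or-T-not (eqF w as))
      where
        step-outside-B : ParentStep I/KZ p' ρ' v → T (inB I/KZ v) → T (inA I/KZ (p' v)) → T (eqF (p' v) as) ⊎ T (not (eqF (p' v) as)) → ParentStep I parent rank v
        step-outside-B P vB' wA' (inj₁ e) =
          let we = eqF-sound e
              Eas : T (E I/KZ as v)
              Eas = subst (λ x → T (E I/KZ x v)) we (proj₂ (ParentStep.fromB P vB'))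
              ex = any-elim _ (E'as v Eas)
              k = pick a0 (λ k → K k ∧ E I k v)
              kspec = pick-spec a0 (λ k → K k ∧ E I k v) (proj₁ ex) (proj₂ ex)
              kK = T∧₁ kspec
              lt : ρ' as < ρ' v
              lt = subst (λ x → ρ' x < ρ' v) we (ParentStep.rank-< P)
              ineq : scale * ρ' as + ρJ k < scale * ρ' v
              ineq = ≤-trans (+-monoʳ-< (scale * ρ' as) (ρJ<scale k))
                       (≤-trans (≤-reflexive (trans (+-comm (scale * ρ' as) scale) (sym (*-suc scale (ρ' as))))) (*-monoʳ-≤ scale lt))
          in stepVia v k (parent-redirected v nkz we) (λ a → ⊥-elim (disj v a b)) (λ _ → KA k kK , T∧₂ {K k} kspec)
               (subst₂ _<_ (sym (rank-inside k (T∨₁ kK))) (sym (rank-outside v nkz)) ineq)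
        step-outside-B P vB' wA' (inj₂ ne') =
          let w = p' v
              wne : w ≢ as
              wne e = T-not⇒¬T ne' (subst (λ x → T (eqF x as)) (sym e) (eqF-refl as))
              wnkz = outKZ w (inA⇒inV I/KZ w wA') wne
          in stepVia v w (parent-outside v nkz wne) (λ a → ⊥-elim (disj v a b))
               (λ _ → A'A w wA' , E'o w v wne (proj₂ (ParentStep.fromB P vB')))
               (subst₂ _<_ (sym (rank-outside w wnkz)) (sym (rank-outside v nkz)) (*-monoʳ-< scale (ParentStep.rank-< P)))

    step : ∀ v → T (inV I v) → v ≢ a0 → ParentStep I parent rank v
    step v iv ne with T-or-T-not (KZ v)
    ... | inj₂ nkz = step-outside v iv (T-not⇒¬T nkz) ne
    ... | inj₁ kz with T-or-T-not (eqF v k0)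
    ...   | inj₁ e = subst (ParentStep I parent rank) (sym (eqF-sound e)) (step-k0 (λ e' → ne (trans (eqF-sound e) e')))
    ...   | inj₂ f = step-inside v kz (λ e' → T-not⇒¬T f (subst (λ x → T (eqF v x)) e' (eqF-refl v)))

    child : ∀ b → T (inB I b) → Σ (Fin n) λ c → T (inV I c) × c ≢ a0 × parent c ≡ b
    child b bB with T-or-T-not (Z b)
    ... | inj₁ z = chZ (childJ b z)
      where
        cIf : ∀ {c} → T (K c) ⊎ T (Z c) → T (inV I c)
        cIf {c} (inj₁ k) = inA⇒inV I c (KA c k)
        cIf {c} (inj₂ z) = inB⇒inV I c (ZB c z)
        chZ : (Σ (Fin n) λ c → T (inV I↾KZ c) × c ≢ k0 × pJ c ≡ b) → Σ (Fin n) λ c → T (inV I c) × c ≢ a0 × parent c ≡ b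
        chZ (c , ic , cne , e) = c , cIf (T∨-elim {K c} ic) , ca0 , trans (parent-inside c ic cne) e
          where
            ca0 : c ≢ a0
            ca0 ea = aux mode
              where aux : Placement → ⊥
                    aux (inj₁ (_ , ek , _)) = cne (trans ea (sym ek))
                    aux (inj₂ (nKa0 , _ , _)) with T∨-elim {K c} ic
                    ... | inj₁ k = nKa0 (subst (λ x → T (K x)) ea k)
                    ... | inj₂ z' = ZnA c z' (subst (λ x → T (inA I x)) (sym ea) Aa0)
    ... | inj₂ nz = fin0 (child' b (nZ→B' b bB (T-not⇒¬T nz)))
      where
        inI'→I : ∀ c → T (inV I/KZ c) → T (inV I c)
        inI'→I c t with inV-elim I/KZ c t
        ... | inj₁ a = inA⇒inV I c (A'A c a)
        ... | inj₂ b = inB⇒inV I c (B'B c b)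
        fin : ∀ c' → T (inV I/KZ c') → c' ≢ r' → p' c' ≡ b → T (eqF c' as) ⊎ T (not (eqF c' as)) → Σ (Fin n) λ c → T (inV I c) × c ≢ a0 × parent c ≡ b
        fin c' ic' cne' e' (inj₁ eq) = aux mode
          where
            ceq = eqF-sound eq
            aux : Placement → Σ (Fin n) λ c → T (inV I c) × c ≢ a0 × parent c ≡ b
            aux (inj₁ (_ , _ , er')) = ⊥-elim (cne' (trans ceq (sym er')))
            aux (inj₂ (nKa0 , _ , _)) = k0 , inA⇒inV I k0 (KA k0 Kk0) , (λ e → nKa0 (subst (λ x → T (K x)) e Kk0)) ,
                                         trans parent-k0 (trans (cong p' (sym ceq)) e')
        fin c' ic' cne' e' (inj₂ neq) = c' , inI'→I c' ic' , ca0 , trans (parent-outside c' cnkz bne) e'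
          where
            cne : c' ≢ as
            cne e = T-not⇒¬T neq (subst (λ x → T (eqF c' x)) e (eqF-refl c'))
            cnkz = outKZ c' ic' cne
            bne : p' c' ≢ as
            bne e = KnB as Kas (subst (λ x → T (inB I x)) (trans (sym e') e) bB)
            ca0 : c' ≢ a0
            ca0 ea = aux mode
              where aux : Placement → ⊥
                    aux (inj₁ (Ka0 , _ , _)) = cnkz (T∨₁ (subst (λ x → T (K x)) (sym ea) Ka0))
                    aux (inj₂ (_ , er' , _)) = cne' (trans ea (sym er'))
        fin0 : (Σ (Fin n) λ c → T (inV I/KZ c) × c ≢ r' × p' c ≡ b) → Σ (Fin n) λ c → T (inV I c) × c ≢ a0 × parent c ≡ b
        fin0 (c' , ic' , cne' , e') = fin c' ic' cne' e' (T-or-T-not (eqF c' as))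

    glued : ParentTree I a0
    glued = parentTree parent rank step child

  glue : (∀ k → T (K k) → ParentTree I↾KZ k) → (∀ r → T (inA I/KZ r) → ParentTree I/KZ r) → ∀ a0 → T (inA I a0) → ParentTree I a0
  glue innerTree outerTree a0 Aa0 with T-or-T-not (K a0)
  ... | inj₁ k = Glue.glued as (outerTree as Aas') a0 (innerTree a0 k) k a0 Aa0 (inj₁ (k , refl , refl))
  ... | inj₂ nk =
    let S' = outerTree a0 (nK→A' a0 Aa0 (T-not⇒¬T nk))
        c = ParentTree.p S' as
        asne : as ≢ a0
        asne e = T-not⇒¬T nk (subst (λ x → T (K x)) e Kas)
        P = ParentTree.step S' as (inA⇒inV I/KZ as Aas') asne
        ex = any-elim _ (E'as c (proj₂ (ParentStep.fromA P Aas')))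
        k0 = pick a0 (λ k → K k ∧ E I k c)
        ks = pick-spec a0 (λ k → K k ∧ E I k c) (proj₁ ex) (proj₂ ex)
    in Glue.glued a0 S' k0 (innerTree k0 (T∧₁ ks)) (T∧₁ ks) a0 Aa0 (inj₂ (T-not⇒¬T nk , refl , T∧₂ {K k0} ks))

module ContractionProperties {n : ℕ} (I : Bigraph n) (K Z : Fin n → Bool) (as : Fin n)
  (disj : Disjoint I) (KA : ∀ v → T (K v) → T (inA I v)) (ZB : ∀ v → T (Z v) → T (inB I v)) (Kas : T (K as)) where
  open Contraction I K Z as disj KA ZB Kas

  contract-disjoint : Disjoint I/KZ
  contract-disjoint v a b = disj v (A'A v a) (B'B v b)

  contract-size-< : ∀ z → T (Z z) → size I/KZ < size I
  contract-size-< z tz = +-mono-≤-< (count-mono _ _ A'A) (count-mono-< _ _ B'B z (ZB z tz) (λ t → B'nZ z t tz))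

  private
    nbhd′ : (Fin n → Bool) → Fin n → Bool
    nbhd′ Y = nbhd I/KZ Y
    touchesK : (Fin n → Bool) → Bool
    touchesK Y = any (λ a → K a ∧ nbhd I Y a)

  nbhd-contracted : ∀ Y → SubsetOfB I/KZ Y → ∀ a → nbhd′ Y a ≡ ((nbhd I Y a ∧ not (K a)) ∨ (eqF a as ∧ touchesK Y))
  nbhd-contracted Y sub a with T-or-T-not (eqF a as)
  ... | inj₁ e rewrite eqF-sound e = T-ext f g
    where
      f : T (nbhd′ Y as) → T ((nbhd I Y as ∧ not (K as)) ∨ (eqF as as ∧ touchesK Y))
      f t = let (b , tb) = any-elim _ (T∧₂ {inA I/KZ as} t)
                Eb = E'as b (T∧₂ {Y b} tb)
                (k , tk) = any-elim _ Eb
                Kk : T (K k)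
                Kk = T∧₁ tk
                Yb : T (Y b)
                Yb = T∧₁ tb
            in T∨₂ {nbhd I Y as ∧ not (K as)} (T∧ (eqF-refl as) (any-intro (λ a → K a ∧ nbhd I Y a) k (T∧ Kk (T∧ (KA k Kk) (any-intro (λ b' → Y b' ∧ E I k b') b (T∧ Yb (T∧₂ {K k} tk)))))))
      g : T ((nbhd I Y as ∧ not (K as)) ∨ (eqF as as ∧ touchesK Y)) → T (nbhd′ Y as)
      g t with T∨-elim {nbhd I Y as ∧ not (K as)} t
      ... | inj₁ x = ⊥-elim (T-not⇒¬T (T∧₂ {nbhd I Y as} x) Kas)
      ... | inj₂ y = let (k , tk) = any-elim _ (T∧₂ {eqF as as} y)
                         Kk = T∧₁ tk
                         (b , tb) = any-elim _ (T∧₂ {inA I k} (T∧₂ {K k} tk))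
                         Eas : T (E I/KZ as b)
                         Eas = subst T (sym (if-t {b = eqF as as} {x = any (λ k → K k ∧ E I k b)} {y = E I as b} (eqF-refl as)))
                                 (any-intro _ k (T∧ Kk (T∧₂ {Y b} tb)))
                     in T∧ Aas' (any-intro _ b (T∧ (T∧₁ tb) Eas))
  ... | inj₂ ne = T-ext f g
    where
      ne' : a ≢ as
      ne' e = T-not⇒¬T ne (subst (λ x → T (eqF a x)) e (eqF-refl a))
      f : T (nbhd′ Y a) → T ((nbhd I Y a ∧ not (K a)) ∨ (eqF a as ∧ touchesK Y))
      f t = let aA' = T∧₁ t
                (b , tb) = any-elim _ (T∧₂ {inA I/KZ a} t)
            in T∨₁ (T∧ (T∧ (A'A a aA') (any-intro _ b (T∧ (T∧₁ tb) (E'o a b ne' (T∧₂ {Y b} tb))))) (¬T⇒T-not (A'nK a aA' ne')))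
      g : T ((nbhd I Y a ∧ not (K a)) ∨ (eqF a as ∧ touchesK Y)) → T (nbhd′ Y a)
      g t with T∨-elim {nbhd I Y a ∧ not (K a)} t
      ... | inj₂ y = ⊥-elim (T-not⇒¬T ne (T∧₁ y))
      ... | inj₁ x = let nk = T-not⇒¬T (T∧₂ {nbhd I Y a} x)
                         aA = T∧₁ (T∧₁ x)
                         (b , tb) = any-elim _ (T∧₂ {inA I a} (T∧₁ x))
                         Eab : T (E I/KZ a b)
                         Eab = subst T (sym (if-f {b = eqF a as} {x = any (λ k → K k ∧ E I k b)} {y = E I a b} (T-not⇒¬T ne))) (T∧₂ {Y b} tb)
                     in T∧ (nK→A' a aA nk) (any-intro _ b (T∧ (T∧₁ tb) Eab))

  count-at-root : ∀ (c : Bool) → count (λ a → eqF a as ∧ c) ≡ (if c then 1 else 0)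
  count-at-root true = trans (count-cong _ _ (λ a → ∧-true (eqF a as))) (count-singleton as)
    where ∧-true : ∀ x → (x ∧ true) ≡ x
          ∧-true true = refl
          ∧-true false = refl
  count-at-root false = count-none _ (λ a t → T∧₂ {eqF a as} t)

  contract-surplus : Surplus I → (∀ Y → SubsetOfB I/KZ Y → ∀ y → T (Y y) → T (touchesK Y) → count Y ≤ count (λ a → nbhd I Y a ∧ not (K a))) → Surplus I/KZ
  contract-surplus surp cond Y sub y ty =
    let subI : SubsetOfB I Y
        subI v t = B'B v (sub v t)
        e1 : count (nbhd′ Y) ≡ count (λ a → nbhd I Y a ∧ not (K a)) + (if touchesK Y then 1 else 0)
        e1 = trans (count-cong _ _ (nbhd-contracted Y sub))
               (trans (count-disjoint-∨ _ _ (λ a t1 t2 → T-not⇒¬T (T∧₂ {nbhd I Y a} t1) (subst (λ x → T (K x)) (sym (eqF-sound (T∧₁ t2))) Kas)))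
                      (cong (count (λ a → nbhd I Y a ∧ not (K a)) +_) (count-at-root (touchesK Y))))
    in subst (suc (count Y) ≤_) (sym e1) (fin (T-or-T-not (touchesK Y)) subI)
    where
      fin : T (touchesK Y) ⊎ T (not (touchesK Y)) → SubsetOfB I Y → suc (count Y) ≤ count (λ a → nbhd I Y a ∧ not (K a)) + (if touchesK Y then 1 else 0)
      fin (inj₁ c) subI rewrite if-t {b = touchesK Y} {x = 1} {y = 0} c =
        subst (suc (count Y) ≤_) (+-comm 1 _) (s≤s (cond Y sub y ty c))
      fin (inj₂ nc) subI rewrite if-f {b = touchesK Y} {x = 1} {y = 0} (T-not⇒¬T nc) =
        let s = surp Y subI y ty
            e : count (λ a → nbhd I Y a ∧ K a) ≡ 0
            e = count-none _ (λ a t → T-not⇒¬T nc (any-intro _ a (T∧ (T∧₂ {nbhd I Y a} t) (T∧₁ t))))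
            sp = count-split (nbhd I Y) K
        in subst (suc (count Y) ≤_) (trans sp (trans (cong (_+ count (λ a → nbhd I Y a ∧ not (K a))) e) (sym (+-identityʳ _)))) s

  contract-connected : IsConnected I → (∀ a z → T (inA I a) → T (Z z) → T (E I a z) → T (K a)) → IsConnected I/KZ
  contract-connected conn NZK C' resp' u v iu iv =
    let C : Fin n → Bool
        C w = if (K w ∨ Z w) then C' as else C' w
        respC : Respects I C
        respC = rc
        e = conn C respC u v (inI'I u iu) (inI'I v iv)
    in trans (sym (CC u iu)) (trans e (CC v iv))
    where
      inI'I : ∀ w → T (inV I/KZ w) → T (inV I w)
      inI'I w t with inV-elim I/KZ w t
      ... | inj₁ a = inA⇒inV I w (A'A w a)
      ... | inj₂ b = inB⇒inV I w (B'B w b)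
      CC : ∀ w → T (inV I/KZ w) → (if (K w ∨ Z w) then C' as else C' w) ≡ C' w
      CC w t with T-or-T-not (K w ∨ Z w)
      ... | inj₂ nk = if-f {b = K w ∨ Z w} (T-not⇒¬T nk)
      ... | inj₁ kz with T-or-T-not (eqF w as)
      ...   | inj₁ e = trans (if-t {b = K w ∨ Z w} kz) (cong C' (sym (eqF-sound e)))
      ...   | inj₂ ne = ⊥-elim (outKZ w t (λ e → T-not⇒¬T ne (subst (λ x → T (eqF w x)) e (eqF-refl w))) kz)
      rc : Respects I (λ w → if (K w ∨ Z w) then C' as else C' w)
      rc a b ta tb eab with T-or-T-not (Z b)
      ... | inj₁ z = trans (if-t {b = K a ∨ Z a} (T∨₁ (NZK a b ta z eab))) (sym (if-t {b = K b ∨ Z b} (T∨₂ {K b} z)))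
      ... | inj₂ nz' with T-or-T-not (K a)
      ...   | inj₁ k = trans (if-t {b = K a ∨ Z a} (T∨₁ k))
                         (trans (resp' as b Aas' (nZ→B' b tb nz) (subst T (sym (if-t {b = eqF as as} {x = any (λ k → K k ∧ E I k b)} {y = E I as b} (eqF-refl as))) (any-intro _ a (T∧ k eab))))
                                (sym (if-f {b = K b ∨ Z b} (λ t → nkzb t))))
        where nz = T-not⇒¬T nz'
              nkzb : T (K b ∨ Z b) → ⊥
              nkzb t with T∨-elim {K b} t
              ... | inj₁ kb = KnB b kb tb
              ... | inj₂ zb = nz zb
      ...   | inj₂ nk' = trans (if-f {b = K a ∨ Z a} nkza)
                          (trans (resp' a b (nK→A' a ta nk) (nZ→B' b tb nz) (subst T (sym (if-f {b = eqF a as} {x = any (λ k → K k ∧ E I k b)} {y = E I a b} (λ e → nk (subst (λ x → T (K x)) (sym (eqF-sound e)) Kas)))) eab))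
                                 (sym (if-f {b = K b ∨ Z b} nkzb)))
        where nz = T-not⇒¬T nz'
              nk = T-not⇒¬T nk'
              nkza : T (K a ∨ Z a) → ⊥
              nkza t with T∨-elim {K a} t
              ... | inj₁ ka = nk ka
              ... | inj₂ za = ZnA a za ta
              nkzb : T (K b ∨ Z b) → ⊥
              nkzb t with T∨-elim {K b} t
              ... | inj₁ kb = KnB b kb tb
              ... | inj₂ zb = nz zb

module TightSet {n : ℕ} (I : Bigraph n) (disj : Disjoint I) (conn : IsConnected I) (surp : Surplus I)
  (X : Fin n → Bool) (subX : SubsetOfB I X) (x : Fin n) (tx : T (X x))
  (tight : count (nbhd I X) ≡ suc (count X)) (bo : Fin n) (tbo : T (inB I bo)) (nxb : ¬ T (X bo)) where

  K : Fin n → Bool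
  K = nbhd I X

  I↾KZ : Bigraph n
  I↾KZ = restrict I K X

  KA : ∀ v → T (K v) → T (inA I v)
  KA v t = T∧₁ t

  disjoint-↾ : Disjoint I↾KZ
  disjoint-↾ v a b = disj v (KA v a) (subX v b)

  size-↾ : size I↾KZ < size I
  size-↾ = +-mono-≤-< (count-mono _ _ KA) (count-mono-< X (inB I) subX bo tbo nxb)

  surplus-↾ : Surplus I↾KZ
  surplus-↾ Y sub y ty = ≤-trans (surp Y (λ v t → subX v (sub v t)) y ty) (count-mono _ _ f)
    where f : ∀ a → T (nbhd I Y a) → T (nbhd I↾KZ Y a)
          f a t = let (b , tb) = any-elim _ (T∧₂ {inA I a} t)
                      Yb : T (Y b)
                      Yb = T∧₁ tb
                  in T∧ (T∧ (T∧₁ t) (any-intro (λ b' → X b' ∧ E I a b') b (T∧ (sub b Yb) (T∧₂ {Y b} tb)))) (any-intro (λ b' → Y b' ∧ E I a b') b tb)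

  -- A colouring splitting X would split N(X) into the disjoint neighbourhoods of the two parts,
  -- and their surpluses would give |N(X)| ≥ |X| + 2.
  connected-↾ : IsConnected I↾KZ
  connected-↾ C resp u v iu iv = trans (toX u iu) (sym (toX v iv))
    where
      X1 X2 : Fin n → Bool
      X1 w = X w ∧ C w
      X2 w = X w ∧ not (C w)
      N1 : ∀ a → T (nbhd I X1 a) → T (C a)
      N1 a t = let (b , tb) = any-elim _ (T∧₂ {inA I a} t)
                   X1b : T (X1 b)
                   X1b = T∧₁ tb
                   Xb : T (X b)
                   Xb = T∧₁ X1b
                   e = resp a b (T∧ (T∧₁ t) (any-intro (λ b' → X b' ∧ E I a b') b (T∧ Xb (T∧₂ {X1 b} tb)))) Xb (T∧₂ {X1 b} tb)
               in subst T (sym e) (T∧₂ {X b} X1b)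
      N2 : ∀ a → T (nbhd I X2 a) → ¬ T (C a)
      N2 a t ca = let (b , tb) = any-elim _ (T∧₂ {inA I a} t)
                      X2b : T (X2 b)
                      X2b = T∧₁ tb
                      Xb : T (X b)
                      Xb = T∧₁ X2b
                      e = resp a b (T∧ (T∧₁ t) (any-intro (λ b' → X b' ∧ E I a b') b (T∧ Xb (T∧₂ {X2 b} tb)))) Xb (T∧₂ {X2 b} tb)
                  in T-not⇒¬T (T∧₂ {X b} X2b) (subst T e ca)
      noboth : ∀ y1 y2 → T (X1 y1) → T (X2 y2) → ⊥
      noboth y1 y2 t1 t2 =
        let s1 = surp X1 (λ w t → subX w (T∧₁ t)) y1 t1
            s2 = surp X2 (λ w t → subX w (T∧₁ t)) y2 t2
            d = count-disjoint-∨ (nbhd I X1) (nbhd I X2) (λ a p q → N2 a q (N1 a p))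
            m : count (λ a → nbhd I X1 a ∨ nbhd I X2 a) ≤ count (nbhd I X)
            m = count-mono _ _ (λ a t → sub12 a (T∨-elim {nbhd I X1 a} t))
            sp = count-split X C
            ineq : suc (suc (count X)) ≤ suc (count X)
            ineq = ≤-trans (≤-reflexive (cong (λ k → suc (suc k)) sp))
                     (≤-trans (≤-reflexive (cong suc (sym (+-suc (count X1) (count X2)))))
                       (≤-trans (+-mono-≤ s1 s2) (≤-trans (≤-reflexive (sym d)) (≤-trans m (≤-reflexive tight)))))
        in 1+n≰n ineq
        where
          sub12 : ∀ a → T (nbhd I X1 a) ⊎ T (nbhd I X2 a) → T (nbhd I X a)
          sub12 a (inj₁ t) = let (b , tb) = any-elim _ (T∧₂ {inA I a} t) in
                             T∧ (T∧₁ t) (any-intro (λ b' → X b' ∧ E I a b') b (T∧ (T∧₁ (T∧₁ tb)) (T∧₂ {X1 b} tb)))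
          sub12 a (inj₂ t) = let (b , tb) = any-elim _ (T∧₂ {inA I a} t) in
                             T∧ (T∧₁ t) (any-intro (λ b' → X b' ∧ E I a b') b (T∧ (T∧₁ (T∧₁ tb)) (T∧₂ {X2 b} tb)))
      sameX : ∀ y → T (X y) → C y ≡ C x
      sameX y ty with C y in ey | C x in ex
      ... | true | true = refl
      ... | false | false = refl
      ... | true | false = ⊥-elim (noboth y x (T∧ ty (subst T (sym ey) tt)) (T∧ tx (subst T (cong not (sym ex)) tt)))
      ... | false | true = ⊥-elim (noboth x y (T∧ tx (subst T (sym ex) tt)) (T∧ ty (subst T (cong not (sym ey)) tt)))
      toX : ∀ w → T (inV I↾KZ w) → C w ≡ C x
      toX w t with T∨-elim {K w} t
      ... | inj₂ xw = sameX w xw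
      ... | inj₁ kw = let (b , tb) = any-elim _ (T∧₂ {inA I w} kw)
                          Xb : T (X b)
                          Xb = T∧₁ tb
                      in trans (resp w b kw Xb (T∧₂ {X b} tb)) (sameX b Xb)

  asE : Σ (Fin n) λ a → T (K a)
  asE = count-pos⇒witness K (subst (1 ≤_) (sym tight) (s≤s z≤n))

  as : Fin n
  as = proj₁ asE

  open ContractionProperties I K X as disj KA subX (proj₂ asE)
  open Contraction I K X as disj KA subX (proj₂ asE) using (I/KZ)

  disjoint-/ : Disjoint I/KZ
  disjoint-/ = contract-disjoint

  size-/ : size I/KZ < size I
  size-/ = contract-size-< x tx

  connected-/ : IsConnected I/KZ
  connected-/ = contract-connected conn (λ a z ta tz e → T∧ ta (any-intro (λ b' → X b' ∧ E I a b') z (T∧ tz e)))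

  surplus-/ : Surplus I/KZ
  surplus-/ = contract-surplus surp cond
    where
      cond : ∀ Y → SubsetOfB I/KZ Y → ∀ y → T (Y y) → _ → count Y ≤ count (λ a → nbhd I Y a ∧ not (K a))
      cond Y sub y ty _ =
        let XY : Fin n → Bool
            XY w = X w ∨ Y w
            nYX : ∀ w → T (X w) → T (Y w) → ⊥
            nYX w tx' ty' = T-not⇒¬T (T∧₂ {inB I w} (sub w ty')) tx'
            subXY : SubsetOfB I XY
            subXY w t = subXYf w (T∨-elim {X w} t)
            s = surp XY subXY y (T∨₂ {X y} ty)
            e1 : count XY ≡ count X + count Y
            e1 = count-disjoint-∨ X Y nYX
            e2 : count (nbhd I XY) ≡ count K + count (λ a → nbhd I Y a ∧ not (K a))
            e2 = trans (count-cong _ _ pt) (count-disjoint-∨ K _ (λ a t1 t2 → T-not⇒¬T (T∧₂ {nbhd I Y a} t2) t1))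
            ineq : suc (count X) + count Y ≤ suc (count X) + count (λ a → nbhd I Y a ∧ not (K a))
            ineq = subst₂ _≤_ (cong suc e1) (trans e2 (cong (_+ count (λ a → nbhd I Y a ∧ not (K a))) tight)) s
        in +-cancelˡ-≤ (suc (count X)) _ _ ineq
        where
          subXYf : ∀ w → T (X w) ⊎ T (Y w) → T (inB I w)
          subXYf w (inj₁ a) = subX w a
          subXYf w (inj₂ b) = T∧₁ (sub w b)
          pt : ∀ a → nbhd I (λ w → X w ∨ Y w) a ≡ (K a ∨ (nbhd I Y a ∧ not (K a)))
          pt a = T-ext f g
            where
              f : T (nbhd I (λ w → X w ∨ Y w) a) → T (K a ∨ (nbhd I Y a ∧ not (K a)))
              f t with any-elim _ (T∧₂ {inA I a} t)
              ... | b , tb with T∨-elim {X b} (T∧₁ {X b ∨ Y b} tb)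
              ... | inj₁ xb = T∨₁ {K a} (T∧ (T∧₁ t) (any-intro (λ b' → X b' ∧ E I a b') b (T∧ xb (T∧₂ {X b ∨ Y b} tb))))
              ... | inj₂ yb with T-or-T-not (K a)
              ...   | inj₁ k = T∨₁ {K a} k
              ...   | inj₂ nk = T∨₂ {K a} (T∧ (T∧ (T∧₁ t) (any-intro (λ b' → Y b' ∧ E I a b') b (T∧ yb (T∧₂ {X b ∨ Y b} tb)))) nk)
              g : T (K a ∨ (nbhd I Y a ∧ not (K a))) → T (nbhd I (λ w → X w ∨ Y w) a)
              g t with T∨-elim {K a} t
              ... | inj₁ k = let (b , tb) = any-elim _ (T∧₂ {inA I a} k) in
                             T∧ (T∧₁ k) (any-intro (λ b' → (X b' ∨ Y b') ∧ E I a b') b (T∧ (T∨₁ {X b} (T∧₁ {X b} tb)) (T∧₂ {X b} tb)))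
              ... | inj₂ r = let q = T∧₁ r
                                 (b , tb) = any-elim _ (T∧₂ {inA I a} q) in
                             T∧ (T∧₁ q) (any-intro (λ b' → (X b' ∨ Y b') ∧ E I a b') b (T∧ (T∨₂ {X b} (T∧₁ {Y b} tb)) (T∧₂ {Y b} tb)))

module NoTightSet {n : ℕ} (I : Bigraph n) (disj : Disjoint I) (conn : IsConnected I) (surp : Surplus I)
  (b : Fin n) (tb : T (inB I b))
  (surplus₂ : ∀ Y → SubsetOfB I Y → ∀ y → T (Y y) → ¬ T (Y b) → suc (suc (count Y)) ≤ count (nbhd I Y)) where

  B-b : Fin n → Bool
  B-b v = inB I v ∧ not (eqF v b)
  I-b : Bigraph n
  I-b = bigraph (inA I) B-b (E I)

  edgeB : Fin n → Fin n → Bool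
  edgeB a c = inA I a ∧ (B-b c ∧ E I a c)
  respB : (Fin n → Bool) → Bool
  respB C = all (λ a → all (λ c → not (edgeB a c) ∨ eqB (C a) (C c)))

  respB-sound : ∀ C → T (respB C) → Respects I-b C
  respB-sound C t a c ta tc e = eqB-sound (h (T∨-elim {not (edgeB a c)} (all-elim _ (all-elim _ t a) c)))
    where h : T (not (edgeB a c)) ⊎ T (eqB (C a) (C c)) → T (eqB (C a) (C c))
          h (inj₁ x) = ⊥-elim (T-not⇒¬T x (T∧ {inA I a} ta (T∧ {B-b c} tc e)))
          h (inj₂ y) = y
  respB-complete : ∀ C → Respects I-b C → T (respB C)
  respB-complete C r = all-intro _ (λ a → all-intro _ (λ c → h a c (T-or-T-not (edgeB a c))))
    where h : ∀ a c → T (edgeB a c) ⊎ T (not (edgeB a c)) → T (not (edgeB a c) ∨ eqB (C a) (C c))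
          h a c (inj₁ t) = T∨₂ {not (edgeB a c)} (eqB-complete (r a c (T∧₁ {inA I a} t) (T∧₁ {B-b c} (T∧₂ {inA I a} t)) (T∧₂ {B-b c} (T∧₂ {inA I a} t))))
          h a c (inj₂ f) = T∨₁ {not (edgeB a c)} f
  respB-ext : ∀ C C' → (∀ v → C v ≡ C' v) → respB C ≡ respB C'
  respB-ext C C' e = all-cong _ _ (λ a → all-cong _ _ (λ c → cong₂ (λ x y → not (edgeB a c) ∨ eqB x y) (e a) (e c)))

  splitP : Fin n → Fin n → (Fin n → Bool) → Bool
  splitP u v C = respB C ∧ not (eqB (C u) (C v))
  splitP-ext : ∀ u v C C' → (∀ w → C w ≡ C' w) → splitP u v C ≡ splitP u v C'
  splitP-ext u v C C' e = cong₂ (λ x y → x ∧ not y) (respB-ext C C' e) (cong₂ eqB (e u) (e v))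

  opaque
    -- u and v are linked when no colouring constant along the edges of I − b separates them, i.e. they
    -- lie in one component of I − b; this is decided by enumerating all colourings.
    linked : Fin n → Fin n → Bool
    linked u v = isRight (∃-subset? (splitP u v) (splitP-ext u v))

    linked-sound : ∀ u v → T (linked u v) → ∀ C → Respects I-b C → C u ≡ C v
    linked-sound u v t C r with ∃-subset? (splitP u v) (splitP-ext u v)
    ... | inj₁ _ = ⊥-elim t
    ... | inj₂ f = eqB-sound (h (T-or-T-not (eqB (C u) (C v))))
      where h : T (eqB (C u) (C v)) ⊎ T (not (eqB (C u) (C v))) → T (eqB (C u) (C v))
            h (inj₁ x) = x
            h (inj₂ y) = ⊥-elim (f C (T∧ {respB C} (respB-complete C r) y))
    linked-complete : ∀ u v → (∀ C → Respects I-b C → C u ≡ C v) → T (linked u v)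
    linked-complete u v f with ∃-subset? (splitP u v) (splitP-ext u v)
    ... | inj₁ (C , t) = T-not⇒¬T (T∧₂ {respB C} t) (eqB-complete (f C (respB-sound C (T∧₁ {respB C} t))))
    ... | inj₂ _ = tt

  linked-refl : ∀ u → T (linked u u)
  linked-refl u = linked-complete u u (λ C r → refl)
  linked-sym : ∀ u v → T (linked u v) → T (linked v u)
  linked-sym u v s = linked-complete v u (λ C r → sym (linked-sound u v s C r))
  linked-trans : ∀ u v w → T (linked u v) → T (linked v w) → T (linked u w)
  linked-trans u v w s1 s2 = linked-complete u w (λ C r → trans (linked-sound u v s1 C r) (linked-sound v w s2 C r))
  linked-edge : ∀ a c → T (inA I a) → T (B-b c) → T (E I a c) → T (linked a c)
  linked-edge a c ta tc e = linked-complete a c (λ C r → r a c ta tc e)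

  adjToB : Fin n → Bool
  adjToB a = inA I a ∧ E I a b

  opaque
    rep : Fin n → Fin n
    rep a = pick a (λ a' → adjToB a' ∧ linked a' a)

    rep-spec : ∀ a → T (adjToB a) → T (adjToB (rep a) ∧ linked (rep a) a)
    rep-spec a ta = pick-spec a (λ a' → adjToB a' ∧ linked a' a) a (T∧ {adjToB a} ta (linked-refl a))

    rep-cong : ∀ a a' → T (adjToB a) → T (linked a a') → rep a ≡ rep a'
    rep-cong a a' ta s = pick-cong a a' _ _ pe a (T∧ {adjToB a} ta (linked-refl a))
      where pe : ∀ v → (adjToB v ∧ linked v a) ≡ (adjToB v ∧ linked v a')
            pe v = cong (adjToB v ∧_) (T-ext (λ t → linked-trans v a a' t s) (λ t → linked-trans v a' a t (linked-sym a a' s)))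

  Rep : Fin n → Bool
  Rep a = adjToB a ∧ eqF a (rep a)

  rep-Rep : ∀ a → T (adjToB a) → T (Rep (rep a))
  rep-Rep a ta =
    let rs = rep-spec a ta
        nr = T∧₁ {adjToB (rep a)} rs
        e : rep (rep a) ≡ rep a
        e = rep-cong (rep a) a nr (T∧₂ {adjToB (rep a)} rs)
    in T∧ {adjToB (rep a)} nr (subst (λ z → T (eqF (rep a) z)) (sym e) (eqF-refl (rep a)))

  Rep-unique : ∀ m1 m2 → T (Rep m1) → T (Rep m2) → T (linked m1 m2) → m1 ≡ m2
  Rep-unique m1 m2 t1 t2 s = trans (eqF-sound (T∧₂ {adjToB m1} t1)) (trans (rep-cong m1 m2 (T∧₁ {adjToB m1} t1) s) (sym (eqF-sound (T∧₂ {adjToB m2} t2))))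

  Zᵇ : Fin n → Bool
  Zᵇ v = eqF v b
  ZB : ∀ v → T (Zᵇ v) → T (inB I v)
  ZB v t = subst (λ z → T (inB I z)) (sym (eqF-sound t)) tb

  nbhd-b⇒adjToB : ∀ a → T (nbhd I Zᵇ a) → T (adjToB a)
  nbhd-b⇒adjToB a t =
    let (b' , tb') = any-elim _ (T∧₂ {inA I a} t)
        e = eqF-sound (T∧₁ {Zᵇ b'} tb')
    in T∧ {inA I a} (T∧₁ {inA I a} t) (subst (λ z → T (E I a z)) e (T∧₂ {Zᵇ b'} tb'))

  degree-b≥2 : 2 ≤ count (nbhd I Zᵇ)
  degree-b≥2 = ≤-trans (≤-reflexive (cong suc (sym (count-singleton b)))) (surp Zᵇ ZB b (eqF-refl b))

  opaque
    a1 : Fin n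
    a1 = proj₁ (count-pos⇒witness (nbhd I Zᵇ) (≤-trans (s≤s z≤n) degree-b≥2))
    ta1 : T (adjToB a1)
    ta1 = nbhd-b⇒adjToB a1 (proj₂ (count-pos⇒witness (nbhd I Zᵇ) (≤-trans (s≤s z≤n) degree-b≥2)))

  m1 : Fin n
  m1 = rep a1
  Mm1 : T (Rep m1)
  Mm1 = rep-Rep a1 ta1

  opaque
    a2 : Fin n
    a2 = proj₁ (count-≥2⇒other (nbhd I Zᵇ) degree-b≥2 m1)
    ta2 : T (adjToB a2)
    ta2 = nbhd-b⇒adjToB a2 (proj₁ (proj₂ (count-≥2⇒other (nbhd I Zᵇ) degree-b≥2 m1)))
    a2ne : a2 ≢ m1
    a2ne = proj₂ (proj₂ (count-≥2⇒other (nbhd I Zᵇ) degree-b≥2 m1))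

  K : Fin n → Bool
  K a = Rep a ∨ eqF a a2

  KN : ∀ a → T (K a) → T (adjToB a)
  KN a t with T∨-elim {Rep a} t
  ... | inj₁ m = T∧₁ {adjToB a} m
  ... | inj₂ e = subst (λ z → T (adjToB z)) (sym (eqF-sound e)) ta2
  KA : ∀ a → T (K a) → T (inA I a)
  KA a t = T∧₁ {inA I a} (KN a t)
  Km1 : T (K m1)
  Km1 = T∨₁ {Rep m1} Mm1
  Ka2 : T (K a2)
  Ka2 = T∨₂ {Rep a2} (eqF-refl a2)

  K≢b : ∀ a → T (K a) → a ≢ b
  K≢b a t e = disj a (KA a t) (subst (λ z → T (inB I z)) (sym e) tb)

  I↾KZ : Bigraph n
  I↾KZ = restrict I K Zᵇ

  other : Fin n → Fin n
  other k = if eqF k m1 then a2 else m1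
  other-K : ∀ k → T (K (other k))
  other-K k with eqF k m1
  ... | true = Ka2
  ... | false = Km1
  other-ne : ∀ k → other k ≢ k
  other-ne k with T-or-T-not (eqF k m1)
  ... | inj₁ e rewrite if-t {b = eqF k m1} {x = a2} {y = m1} e = λ e' → a2ne (trans e' (eqF-sound e))
  ... | inj₂ f rewrite if-f {b = eqF k m1} {x = a2} {y = m1} (T-not⇒¬T f) = λ e' → T-not⇒¬T f (subst (λ z → T (eqF z m1)) e' (eqF-refl m1))

  starTree : ∀ k → T (K k) → ParentTree I↾KZ k
  starTree k tk = parentTree p ρ step child
    where
      p : Fin n → Fin n
      p v = if eqF v b then k else b
      ρ : Fin n → ℕ
      ρ v = if eqF v k then 0 else (if eqF v b then 1 else 2)
      kb : k ≢ b
      kb = K≢b k tk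
      pk : p b ≡ k
      pk = if-t {b = eqF b b} (eqF-refl b)
      pv : ∀ v → v ≢ b → p v ≡ b
      pv v ne = if-f {b = eqF v b} (λ e → ne (eqF-sound e))
      ρk : ρ k ≡ 0
      ρk = if-t {b = eqF k k} (eqF-refl k)
      ρb : ρ b ≡ 1
      ρb = trans (if-f {b = eqF b k} (λ e → kb (sym (eqF-sound e)))) (if-t {b = eqF b b} (eqF-refl b))
      ρv : ∀ v → v ≢ k → v ≢ b → ρ v ≡ 2
      ρv v n1 n2 = trans (if-f {b = eqF v k} (λ e → n1 (eqF-sound e))) (if-f {b = eqF v b} (λ e → n2 (eqF-sound e)))
      step : ∀ v → T (inV I↾KZ v) → v ≢ k → ParentStep I↾KZ p ρ v
      step v iv ne with T∨-elim {K v} iv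
      ... | inj₁ kv = let vb = K≢b v kv in
        parentStep (λ _ → subst (λ z → T (Zᵇ z) × T (E I v z)) (sym (pv v vb)) (eqF-refl b , T∧₂ {inA I v} (KN v kv)))
            (λ z → ⊥-elim (vb (eqF-sound z)))
            (subst₂ _<_ (sym (trans (cong ρ (pv v vb)) ρb)) (sym (ρv v ne vb)) (s≤s (s≤s z≤n)))
      ... | inj₂ zv with eqF-sound {u = v} {v = b} zv
      ...   | refl =
        parentStep (λ t → ⊥-elim (K≢b b t refl))
            (λ _ → subst (λ z → T (K z) × T (E I z b)) (sym pk) (tk , T∧₂ {inA I k} (KN k tk)))
            (subst₂ _<_ (sym (trans (cong ρ pk) ρk)) (sym ρb) (s≤s z≤n))
      child : ∀ b' → T (Zᵇ b') → Σ (Fin n) λ c → T (inV I↾KZ c) × c ≢ k × p c ≡ b'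
      child b' zb = other k , T∨₁ {K (other k)} (other-K k) , other-ne k , trans (pv (other k) (K≢b _ (other-K k))) (sym (eqF-sound zb))

  open ContractionProperties I K Zᵇ m1 disj KA ZB Km1
  open Contraction I K Zᵇ m1 disj KA ZB Km1 using (I/KZ; Aas'; nK→A'; A'nK; E'as; E'o; A'A; B'B)

  disjoint-/ : Disjoint I/KZ
  disjoint-/ = contract-disjoint

  size-/ : size I/KZ < size I
  size-/ = contract-size-< b (eqF-refl b)

  linkedToB : Fin n → Bool
  linkedToB u = any (λ a → adjToB a ∧ linked a u) ∨ eqF u b

  linkedToB-respects : Respects I linkedToB
  linkedToB-respects a c ta tc e with T-or-T-not (eqF c b)
  ... | inj₁ cb with eqF-sound {u = c} {v = b} cb
  ...   | refl = trans (T⇒≡true (T∨₁ {any (λ a' → adjToB a' ∧ linked a' a)} (any-intro (λ a' → adjToB a' ∧ linked a' a) a (T∧ {adjToB a} (T∧ {inA I a} ta e) (linked-refl a)))))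
                       (sym (T⇒≡true (T∨₂ {any (λ a' → adjToB a' ∧ linked a' b)} (eqF-refl b))))
  linkedToB-respects a c ta tc e | inj₂ ncb =
    let s = linked-edge a c ta (T∧ {inB I c} tc ncb) e
        ab : eqF a b ≡ false
        ab = eqF-no (λ e' → disj a ta (subst (λ z → T (inB I z)) (sym e') tb))
    in cong₂ _∨_ (any-cong _ _ (λ x → cong (adjToB x ∧_) (T-ext (λ t → linked-trans x a c t s) (λ t → linked-trans x c a t (linked-sym a c s)))))
                 (trans ab (sym (¬T⇒≡false (T-not⇒¬T ncb))))

  linked-to-adjToB : ∀ u → T (inV I u) → u ≢ b → Σ (Fin n) λ a → T (adjToB a) × T (linked a u)
  linked-to-adjToB u iu ne =
    let e = conn linkedToB linkedToB-respects u b iu (inB⇒inV I b tb)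
        t : T (linkedToB u)
        t = subst T (sym e) (T∨₂ {any (λ a → adjToB a ∧ linked a b)} (eqF-refl b))
    in h (T∨-elim {any (λ a → adjToB a ∧ linked a u)} t)
    where h : T (any (λ a → adjToB a ∧ linked a u)) ⊎ T (eqF u b) → Σ (Fin n) λ a → T (adjToB a) × T (linked a u)
          h (inj₁ x) = let (a , ta) = any-elim _ x in a , T∧₁ {adjToB a} ta , T∧₂ {adjToB a} ta
          h (inj₂ y) = ⊥-elim (ne (eqF-sound y))

  connected-/ : IsConnected I/KZ
  connected-/ C' resp' u v iu iv = trans (toM u iu) (sym (toM v iv))
    where
      C : Fin n → Bool
      C w = C' (if K w then m1 else w)
      CK : ∀ w → T (K w) → C w ≡ C' m1
      CK w t = cong C' (if-t {b = K w} t)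
      CnK : ∀ w → ¬ T (K w) → C w ≡ C' w
      CnK w t = cong C' (if-f {b = K w} t)
      Em1 : ∀ a c → T (K a) → T (E I a c) → T (E I/KZ m1 c)
      Em1 a c ka e = subst T (sym (if-t {b = eqF m1 m1} {x = any (λ k → K k ∧ E I k c)} {y = E I m1 c} (eqF-refl m1)))
                       (any-intro (λ k → K k ∧ E I k c) a (T∧ {K a} ka e))
      respC : Respects I-b C
      respC a c ta tc e with T-or-T-not (K a)
      ... | inj₁ ka = trans (CK a ka) (trans (resp' m1 c Aas' tc (Em1 a c ka e)) (sym (CnK c (λ kc → disj c (KA c kc) (T∧₁ {inB I c} tc)))))
      ... | inj₂ nka' =
        let nka = T-not⇒¬T nka'
            am1 : a ≢ m1
            am1 e' = nka (subst (λ z → T (K z)) (sym e') Km1)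
        in trans (CnK a nka) (trans (resp' a c (nK→A' a ta nka) tc
                 (subst T (sym (if-f {b = eqF a m1} {x = any (λ k → K k ∧ E I k c)} {y = E I a c} (λ e' → am1 (eqF-sound e')))) e))
                 (sym (CnK c (λ kc → disj c (KA c kc) (T∧₁ {inB I c} tc)))))
      I'sub : ∀ w → T (inV I/KZ w) → T (inV I w) × w ≢ b
      I'sub w t with inV-elim I/KZ w t
      ... | inj₁ a = inA⇒inV I w (A'A w a) , (λ e → disj w (A'A w a) (subst (λ z → T (inB I z)) (sym e) tb))
      ... | inj₂ bb = inB⇒inV I w (B'B w bb) , (λ e → T-not⇒¬T (T∧₂ {inB I w} bb) (subst (λ z → T (eqF w z)) e (eqF-refl w)))
      C'C : ∀ w → T (inV I/KZ w) → C' w ≡ C w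
      C'C w t with T-or-T-not (K w)
      ... | inj₂ nk = sym (CnK w (T-not⇒¬T nk))
      ... | inj₁ k with inV-elim I/KZ w t
      ...   | inj₂ bb = ⊥-elim (disj w (KA w k) (B'B w bb))
      ...   | inj₁ aa with T-or-T-not (eqF w m1)
      ...     | inj₁ e = trans (cong C' (eqF-sound e)) (sym (CK w k))
      ...     | inj₂ ne = ⊥-elim (A'nK w aa (λ e → T-not⇒¬T ne (subst (λ z → T (eqF w z)) e (eqF-refl w))) k)
      toM : ∀ w → T (inV I/KZ w) → C' w ≡ C' m1
      toM w t = let (iw , wb) = I'sub w t
                    (a , na , sa) = linked-to-adjToB w iw wb
                    rs = rep-spec a na
                    s : T (linked (rep a) w)
                    s = linked-trans (rep a) a w (T∧₂ {adjToB (rep a)} rs) sa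
                in trans (C'C w t) (trans (sym (linked-sound (rep a) w s C respC)) (CK (rep a) (T∨₁ {Rep (rep a)} (rep-Rep a na))))

  nbhd∖K : (Fin n → Bool) → Fin n → Bool
  nbhd∖K Y a = nbhd I Y a ∧ not (K a)

  splitY : (Fin n → Bool) → (Fin n → Bool) → Bool
  splitY Y C = respB C ∧ (any (λ v → Y v ∧ C v) ∧ any (λ v → Y v ∧ not (C v)))
  splitY-ext : ∀ Y C C' → (∀ w → C w ≡ C' w) → splitY Y C ≡ splitY Y C'
  splitY-ext Y C C' e = cong₂ _∧_ (respB-ext C C' e)
    (cong₂ _∧_ (any-cong _ _ (λ v → cong (Y v ∧_) (e v))) (any-cong _ _ (λ v → cong (λ z → Y v ∧ not z) (e v))))

  nbhd-mono : ∀ Y Y' → (∀ v → T (Y v) → T (Y' v)) → ∀ a → T (nbhd I Y a) → T (nbhd I Y' a)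
  nbhd-mono Y Y' f a t = let (c , tc) = any-elim _ (T∧₂ {inA I a} t) in
    T∧ {inA I a} (T∧₁ {inA I a} t) (any-intro (λ c' → Y' c' ∧ E I a c') c (T∧ {Y' c} (f c (T∧₁ {Y c} tc)) (T∧₂ {Y c} tc)))

  nbhd∖K-mono : ∀ Y Y' → (∀ v → T (Y' v) → T (Y v)) → ∀ a → T (nbhd∖K Y' a) → T (nbhd∖K Y a)
  nbhd∖K-mono Y Y' f a t = T∧ {nbhd I Y a} (nbhd-mono Y' Y f a (T∧₁ {nbhd I Y' a} t)) (T∧₂ {nbhd I Y' a} t)

  -- Split Y along the components of I − b. Within one component N(Y) meets K only in that
  -- component's representative and a2, and surplus 2 pays for both.
  count≤nbhd∖K : ∀ fuel Y → count Y < fuel → (∀ v → T (Y v) → T (B-b v)) → ∀ y → T (Y y) → count Y ≤ count (nbhd∖K Y)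
  count≤nbhd∖K zero Y () sub y ty
  count≤nbhd∖K (suc fuel) Y lt sub y ty with ∃-subset? (splitY Y) (splitY-ext Y)
  ... | inj₁ (C , t) =
    let rC = respB-sound C (T∧₁ {respB C} t)
        t2 = T∧₂ {respB C} t
        (y1 , ty1) = any-elim _ (T∧₁ {any (λ v → Y v ∧ C v)} t2)
        (y2 , ty2) = any-elim _ (T∧₂ {any (λ v → Y v ∧ C v)} t2)
        Y1 : Fin n → Bool
        Y1 v = Y v ∧ C v
        Y2 : Fin n → Bool
        Y2 v = Y v ∧ not (C v)
        lt1 : count Y1 < count Y
        lt1 = count-mono-< Y1 Y (λ v t → T∧₁ {Y v} t) y2 (T∧₁ {Y y2} ty2) (λ t' → T-not⇒¬T (T∧₂ {Y y2} ty2) (T∧₂ {Y y2} t'))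
        lt2 : count Y2 < count Y
        lt2 = count-mono-< Y2 Y (λ v t → T∧₁ {Y v} t) y1 (T∧₁ {Y y1} ty1) (λ t' → T-not⇒¬T (T∧₂ {Y y1} t') (T∧₂ {Y y1} ty1))
        ih1 = count≤nbhd∖K fuel Y1 (≤-trans lt1 (s≤s⁻¹ lt)) (λ v t → sub v (T∧₁ {Y v} t)) y1 ty1
        ih2 = count≤nbhd∖K fuel Y2 (≤-trans lt2 (s≤s⁻¹ lt)) (λ v t → sub v (T∧₁ {Y v} t)) y2 ty2
        N1C : ∀ a → T (nbhd I Y1 a) → C a ≡ true
        N1C a ta = let (c , tc) = any-elim _ (T∧₂ {inA I a} ta)
                       Y1c = T∧₁ {Y1 c} tc
                   in trans (rC a c (T∧₁ {inA I a} ta) (sub c (T∧₁ {Y c} Y1c)) (T∧₂ {Y1 c} tc)) (T⇒≡true (T∧₂ {Y c} Y1c))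
        N2C : ∀ a → T (nbhd I Y2 a) → C a ≡ false
        N2C a ta = let (c , tc) = any-elim _ (T∧₂ {inA I a} ta)
                       Y2c = T∧₁ {Y2 c} tc
                   in trans (rC a c (T∧₁ {inA I a} ta) (sub c (T∧₁ {Y c} Y2c)) (T∧₂ {Y2 c} tc)) (¬T⇒≡false (T-not⇒¬T (T∧₂ {Y c} Y2c)))
        dj : ∀ a → T (nbhd∖K Y1 a) → T (nbhd∖K Y2 a) → ⊥
        dj a t1 t2 = let e = trans (sym (N1C a (T∧₁ {nbhd I Y1 a} t1))) (N2C a (T∧₁ {nbhd I Y2 a} t2)) in subst T e tt
        sub12 : ∀ a → T (nbhd∖K Y1 a ∨ nbhd∖K Y2 a) → T (nbhd∖K Y a)
        sub12 a t = [ nbhd∖K-mono Y Y1 (λ v → T∧₁ {Y v}) a , nbhd∖K-mono Y Y2 (λ v → T∧₁ {Y v}) a ]′ (T∨-elim {nbhd∖K Y1 a} t)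
    in ≤-trans (≤-reflexive (count-split Y C))
         (≤-trans (+-mono-≤ ih1 ih2) (≤-trans (≤-reflexive (sym (count-disjoint-∨ (nbhd∖K Y1) (nbhd∖K Y2) dj))) (count-mono _ _ sub12)))
  ... | inj₂ f =
    let m0 = pick a2 (λ a → nbhd I Y a ∧ Rep a)
        two : ∀ a → T (nbhd I Y a ∧ K a) → a ≡ m0 ⊎ a ≡ a2
        two a t = [ twoM a (T∧₁ {nbhd I Y a} t) , (λ e → inj₂ (eqF-sound e)) ]′ (T∨-elim {Rep a} (T∧₂ {nbhd I Y a} t))
        le2 : count (λ a → nbhd I Y a ∧ K a) ≤ 2
        le2 = count-≤2 _ m0 a2 two
        big : suc (suc (count Y)) ≤ count (nbhd I Y)
        big = surplus₂ Y (λ v t → T∧₁ {inB I v} (sub v t)) y ty (λ yb → T-not⇒¬T (T∧₂ {inB I b} (sub b yb)) (eqF-refl b))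
        sp = count-split (nbhd I Y) K
        ineq : count Y + 2 ≤ count (nbhd∖K Y) + 2
        ineq = ≤-trans (≤-reflexive (+-comm (count Y) 2))
                 (≤-trans big (≤-trans (≤-reflexive sp) (≤-trans (+-monoˡ-≤ _ le2) (≤-reflexive (+-comm 2 _)))))
    in +-cancelʳ-≤ 2 _ _ ineq
    where
      sameC : ∀ C → Respects I-b C → ∀ y1 y2 → T (Y y1) → T (Y y2) → C y1 ≡ C y2
      sameC C r y1 y2 t1 t2 with C y1 in e1 | C y2 in e2
      ... | true | true = refl
      ... | false | false = refl
      ... | true | false = ⊥-elim (f C (T∧ {respB C} (respB-complete C r) (T∧ {any (λ v → Y v ∧ C v)}
                               (any-intro (λ v → Y v ∧ C v) y1 (T∧ {Y y1} t1 (subst T (sym e1) tt)))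
                               (any-intro (λ v → Y v ∧ not (C v)) y2 (T∧ {Y y2} t2 (subst T (cong not (sym e2)) tt))))))
      ... | false | true = ⊥-elim (f C (T∧ {respB C} (respB-complete C r) (T∧ {any (λ v → Y v ∧ C v)}
                               (any-intro (λ v → Y v ∧ C v) y2 (T∧ {Y y2} t2 (subst T (sym e2) tt)))
                               (any-intro (λ v → Y v ∧ not (C v)) y1 (T∧ {Y y1} t1 (subst T (cong not (sym e1)) tt))))))

      allsim : ∀ y1 y2 → T (Y y1) → T (Y y2) → T (linked y1 y2)
      allsim y1 y2 t1 t2 = linked-complete y1 y2 (λ C r → sameC C r y1 y2 t1 t2)
      twoM : ∀ a → T (nbhd I Y a) → T (Rep a) → a ≡ pick a2 (λ a → nbhd I Y a ∧ Rep a) ⊎ a ≡ a2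
      twoM a nya ma =
        let m0 = pick a2 (λ a → nbhd I Y a ∧ Rep a)
            sp = pick-spec a2 (λ a → nbhd I Y a ∧ Rep a) a (T∧ {nbhd I Y a} nya ma)
            (c1 , tc1) = any-elim _ (T∧₂ {inA I a} nya)
            (c2 , tc2) = any-elim _ (T∧₂ {inA I m0} (T∧₁ {nbhd I Y m0} sp))
            Yc1 = T∧₁ {Y c1} tc1
            Yc2 = T∧₁ {Y c2} tc2
            s1 = linked-edge a c1 (T∧₁ {inA I a} nya) (sub c1 Yc1) (T∧₂ {Y c1} tc1)
            s2 = linked-edge m0 c2 (T∧₁ {inA I m0} (T∧₁ {nbhd I Y m0} sp)) (sub c2 Yc2) (T∧₂ {Y c2} tc2)
            s = linked-trans a c1 m0 s1 (linked-trans c1 c2 m0 (allsim c1 c2 Yc1 Yc2) (linked-sym m0 c2 s2))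
        in inj₁ (Rep-unique a m0 ma (T∧₂ {nbhd I Y m0} sp) s)

  surplus-/ : Surplus I/KZ
  surplus-/ = contract-surplus surp (λ Y sub y ty _ → count≤nbhd∖K (suc (count Y)) Y ≤-refl sub y ty)

record ProperTight {n : ℕ} (I : Bigraph n) (X : Fin n → Bool) : Set where
  constructor properTight
  field
    X⊆B      : SubsetOfB I X
    member   : Σ (Fin n) λ x → T (X x)
    tight    : count (nbhd I X) ≡ suc (count X)
    nonmember : Σ (Fin n) λ b → T (inB I b) × ¬ T (X b)

isProperTight : ∀ {n} → Bigraph n → (Fin n → Bool) → Bool
isProperTight I X = all (λ v → not (X v) ∨ inB I v) ∧ (any X ∧ ((count (nbhd I X) ≡ᵇ suc (count X)) ∧ any (λ v → inB I v ∧ not (X v))))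

nbhd-cong : ∀ {n} (I : Bigraph n) X X' → (∀ v → X v ≡ X' v) → ∀ a → nbhd I X a ≡ nbhd I X' a
nbhd-cong I X X' e a = cong (inA I a ∧_) (any-cong _ _ (λ b → cong (_∧ E I a b) (e b)))

isProperTight-cong : ∀ {n} (I : Bigraph n) X X' → (∀ v → X v ≡ X' v) → isProperTight I X ≡ isProperTight I X'
isProperTight-cong I X X' e =
  cong₂ _∧_ (all-cong _ _ (λ v → cong (λ z → not z ∨ inB I v) (e v)))
   (cong₂ _∧_ (any-cong X X' e)
     (cong₂ _∧_ (cong₂ _≡ᵇ_ (count-cong _ _ (nbhd-cong I X X' e)) (cong suc (count-cong X X' e)))
                (any-cong _ _ (λ v → cong (λ z → inB I v ∧ not z) (e v)))))

isProperTight-sound : ∀ {n} (I : Bigraph n) X → T (isProperTight I X) → ProperTight I X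
isProperTight-sound {n} I X t = properTight X⊆B (any-elim X (T∧₁ {any X} t₂)) tight (nonmember (any-elim _ (T∧₂ {count (nbhd I X) ≡ᵇ suc (count X)} t₃)))
  where
    t₂ = T∧₂ {all (λ v → not (X v) ∨ inB I v)} t
    t₃ = T∧₂ {any X} t₂
    X⊆B : SubsetOfB I X
    X⊆B v Xv = [ (λ f → ⊥-elim (T-not⇒¬T f Xv)) , id ]′ (T∨-elim {not (X v)} (all-elim _ (T∧₁ {all (λ v → not (X v) ∨ inB I v)} t) v))
    tight : count (nbhd I X) ≡ suc (count X)
    tight = ≡ᵇ⇒≡ (count (nbhd I X)) (suc (count X)) (T∧₁ {count (nbhd I X) ≡ᵇ suc (count X)} t₃)
    nonmember : (Σ (Fin n) λ b → T (inB I b ∧ not (X b))) → Σ (Fin n) λ b → T (inB I b) × ¬ T (X b)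
    nonmember (b , tb) = b , T∧₁ {inB I b} tb , T-not⇒¬T (T∧₂ {inB I b} tb)

isProperTight-complete : ∀ {n} (I : Bigraph n) X → ProperTight I X → T (isProperTight I X)
isProperTight-complete I X (properTight X⊆B (x , Xx) tight (b , B-b , ¬Xb)) =
  T∧ {all (λ v → not (X v) ∨ inB I v)} (all-intro _ (λ v → [ (λ Xv → T∨₂ {not (X v)} (X⊆B v Xv)) , (λ ¬Xv → T∨₁ {not (X v)} ¬Xv) ]′ (T-or-T-not (X v))))
    (T∧ {any X} (any-intro X x Xx) (T∧ {count (nbhd I X) ≡ᵇ suc (count X)} (≡⇒≡ᵇ _ _ tight)
       (any-intro (λ v → inB I v ∧ not (X v)) b (T∧ {inB I b} B-b (¬T⇒T-not ¬Xb)))))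

properTight? : ∀ {n} (I : Bigraph n) → (Σ (Fin n → Bool) (ProperTight I)) ⊎ (∀ X → ¬ ProperTight I X)
properTight? I with ∃-subset? (isProperTight I) (isProperTight-cong I)
... | inj₁ (X , t) = inj₁ (X , isProperTight-sound I X t)
... | inj₂ none = inj₂ (λ X pt → none X (isProperTight-complete I X pt))

parentTree-without-B : ∀ {n} (I : Bigraph n) → IsConnected I → (∀ v → ¬ T (inB I v)) → ∀ r → T (inA I r) → ParentTree I r
parentTree-without-B {n} I conn noB r Ar = parentTree id (λ _ → 0) (λ v Vv v≢r → ⊥-elim (v≢r (only-r v Vv))) (λ b B-b → ⊥-elim (noB b B-b))
  where
    only-r : ∀ u → T (inV I u) → u ≡ r
    only-r u Vu = eqF-sound (subst T (sym (trans (conn (λ v → eqF v r) (λ a b _ B-b _ → ⊥-elim (noB b B-b)) u r Vu (inA⇒inV I r Ar)) (T⇒≡true (eqF-refl r)))) tt)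

parentTree-by-size : ∀ {n} (fuel : ℕ) (I : Bigraph n) → size I < fuel → Disjoint I → IsConnected I → Surplus I → ∀ r → T (inA I r) → ParentTree I r
parentTree-by-size zero I () disj conn surp r Ar
parentTree-by-size (suc fuel) I lt disj conn surp r Ar with T-or-T-not (any (inB I))
... | inj₂ noB = parentTree-without-B I conn (λ v Bv → T-not⇒¬T noB (any-intro (inB I) v Bv)) r Ar
... | inj₁ someB with properTight? I
...   | inj₁ (X , properTight X⊆B (x , Xx) tight (b , Bb , ¬Xb)) =
  Glued.glue (λ k Kk → recurse Tight.I↾KZ Tight.size-↾ Tight.disjoint-↾ Tight.connected-↾ Tight.surplus-↾ k Kk)
             (λ r' Ar' → recurse Glued.I/KZ Tight.size-/ Tight.disjoint-/ Tight.connected-/ Tight.surplus-/ r' Ar')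
             r Ar
  where
    module Tight = TightSet I disj conn surp X X⊆B x Xx tight b Bb ¬Xb
    module Glued = Contraction I Tight.K X Tight.as disj Tight.KA X⊆B (proj₂ Tight.asE)
    recurse : ∀ J → size J < size I → Disjoint J → IsConnected J → Surplus J → ∀ r → T (inA J r) → ParentTree J r
    recurse J smaller = parentTree-by-size fuel J (≤-trans smaller (s≤s⁻¹ lt))
...   | inj₂ noneTight =
  Glued.glue Loose.starTree (λ r' Ar' → recurse Glued.I/KZ Loose.size-/ Loose.disjoint-/ Loose.connected-/ Loose.surplus-/ r' Ar') r Ar
  where
    b : Fin _
    b = proj₁ (any-elim (inB I) someB)
    Bb : T (inB I b)
    Bb = proj₂ (any-elim (inB I) someB)
    surplus₂ : ∀ Y → SubsetOfB I Y → ∀ y → T (Y y) → ¬ T (Y b) → suc (suc (count Y)) ≤ count (nbhd I Y)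
    surplus₂ Y Y⊆B y Yy ¬Yb = ≤∧≢⇒< (surp Y Y⊆B y Yy) (λ e → noneTight Y (properTight Y⊆B (y , Yy) (sym e) (b , Bb , ¬Yb)))
    module Loose = NoTightSet I disj conn surp b Bb surplus₂
    module Glued = Contraction I Loose.K Loose.Zᵇ Loose.m1 disj Loose.KA Loose.ZB Loose.Km1
    recurse : ∀ J → size J < size I → Disjoint J → IsConnected J → Surplus J → ∀ r → T (inA J r) → ParentTree J r
    recurse J smaller = parentTree-by-size fuel J (≤-trans smaller (s≤s⁻¹ lt))

surplus⇒parentTree : ∀ {n} (I : Bigraph n) → Disjoint I → IsConnected I → Surplus I → ∀ r → T (inA I r) → ParentTree I r
surplus⇒parentTree I = parentTree-by-size (suc (size I)) I ≤-refl

-- Even trees from alternating parent functions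

module TreeFromParents {n : ℕ} (G : Graph n) (B : Fin n → Bool) (a0 : Fin n) (Ba0 : B a0 ≡ false)
  (p : Fin n → Fin n) (ρ : Fin n → ℕ)
  (alternating : ∀ v → v ≢ a0 → T (adj G v (p v)) × B (p v) ≡ not (B v) × ρ (p v) < ρ v)
  (hasChild : ∀ b → B b ≡ true → Σ (Fin n) λ c → c ≢ a0 × p c ≡ b) where

  parentEdge : Fin n → Fin n → Bool
  parentEdge u v = not (eqF u a0) ∧ eqF (p u) v

  treeAdj : Fin n → Fin n → Bool
  treeAdj u v = parentEdge u v ∨ parentEdge v u

  parentEdge-elim : ∀ u v → T (parentEdge u v) → u ≢ a0 × p u ≡ v
  parentEdge-elim u v t = (λ e → T-not⇒¬T (T∧₁ {not (eqF u a0)} t) (subst (λ z → T (eqF u z)) e (eqF-refl u))) ,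
                  eqF-sound (T∧₂ {not (eqF u a0)} t)
  parentEdge-intro : ∀ u v → u ≢ a0 → p u ≡ v → T (parentEdge u v)
  parentEdge-intro u v ne e = T∧ {not (eqF u a0)} (¬T⇒T-not (λ t → ne (eqF-sound t))) (subst (λ z → T (eqF (p u) z)) e (eqF-refl (p u)))

  treeAdj-elim : ∀ u v → T (treeAdj u v) → (u ≢ a0 × p u ≡ v) ⊎ (v ≢ a0 × p v ≡ u)
  treeAdj-elim u v t with T∨-elim {parentEdge u v} t
  ... | inj₁ x = inj₁ (parentEdge-elim u v x)
  ... | inj₂ y = inj₂ (parentEdge-elim v u y)

  parent≢self : ∀ v → v ≢ a0 → p v ≢ v
  parent≢self v ne e = <-irrefl (cong ρ e) (proj₂ (proj₂ (alternating v ne)))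

  tree-loopless : ∀ v → treeAdj v v ≡ false
  tree-loopless v = ¬T⇒≡false f
    where f : T (treeAdj v v) → ⊥
          f t with treeAdj-elim v v t
          ... | inj₁ (ne , e) = parent≢self v ne e
          ... | inj₂ (ne , e) = parent≢self v ne e

  tree : Graph n
  tree = record { adj = treeAdj ; sym = λ u v → ∨-comm (parentEdge u v) (parentEdge v u) ; loopless = tree-loopless }

  tree⊆G : Subgraph tree G
  tree⊆G u v t with treeAdj-elim u v t
  ... | inj₁ (ne , e) = subst (λ z → T (adj G u z)) e (proj₁ (alternating u ne))
  ... | inj₂ (ne , e) = subst T (gsym G v u) (subst (λ z → T (adj G v z)) e (proj₁ (alternating v ne)))

  tree-alternates : ∀ u v → T (treeAdj u v) → B u ≡ not (B v)
  tree-alternates u v t with treeAdj-elim u v t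
  ... | inj₁ (ne , e) = trans (sym (not-involutive (B u))) (cong not (sym (subst (λ z → B z ≡ not (B u)) e (proj₁ (proj₂ (alternating u ne))))))
  ... | inj₂ (ne , e) = subst (λ z → B z ≡ not (B v)) e (proj₁ (proj₂ (alternating v ne)))

  not-flip : ∀ {a b : Bool} → a ≡ not b → b ≡ not a
  not-flip {true} {false} _ = refl
  not-flip {false} {true} _ = refl
  not-flip {true} {true} ()
  not-flip {false} {false} ()

  mutual
    even-walk : ∀ x ys → IsWalk tree (x ∷ ys) → B x ≡ B (lastOr x ys) → Even (length ys)
    even-walk x [] w e = even-zero
    even-walk x (y ∷ ys) (axy , w) e = odd-walk y ys w (trans (not-flip (tree-alternates x y axy)) (cong not e))
    odd-walk : ∀ x ys → IsWalk tree (x ∷ ys) → B x ≡ not (B (lastOr x ys)) → Even (suc (length ys))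
    odd-walk x [] w e = ⊥-elim (not-¬ refl e)
    odd-walk x (y ∷ ys) (axy , w) e = even-ss (even-walk y ys w (trans (not-flip (tree-alternates x y axy)) (trans (cong not e) (not-involutive _))))

  B⇒degree≥2 : ∀ b → B b ≡ true → 2 ≤ degree tree b
  B⇒degree≥2 b lb =
    let bne : b ≢ a0
        bne e = subst T (trans (sym lb) (trans (cong B e) Ba0)) tt
        (c , cne , pc) = hasChild b lb
        t1 : T (treeAdj b (p b))
        t1 = T∨₁ {parentEdge b (p b)} (parentEdge-intro b (p b) bne refl)
        t2 : T (treeAdj b c)
        t2 = T∨₂ {parentEdge b c} (parentEdge-intro c b cne pc)
        diff : p b ≢ c
        diff e = <-asym (subst (λ z → ρ z < ρ c) pc (proj₂ (proj₂ (alternating c cne))))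
                        (subst (λ z → ρ z < ρ b) e (proj₂ (proj₂ (alternating b bne))))
    in subst (2 ≤_) (sym (degree≡count tree b)) (count-≥2 (treeAdj b) (p b) c diff t1 t2)

  leaf⇒notB : ∀ u → Leaf tree u → B u ≡ false
  leaf⇒notB u l with B u in e
  ... | false = refl
  ... | true = ⊥-elim (1+n≰n (subst (2 ≤_) l (B⇒degree≥2 u e)))

  tree-even : EvenTree tree
  tree-even u v lu lv [] ((() , _ , _) , _)
  tree-even u v lu lv (x ∷ ys) ((w , hx , lx) , _) =
    let ex : x ≡ u
        ex = just-injective hx
        ey : lastOr x ys ≡ v
        ey = just-injective (trans (sym (last≡ x ys)) lx)
    in even-walk x ys w (trans (cong B ex) (trans (leaf⇒notB u lu) (sym (trans (cong B ey) (leaf⇒notB v lv)))))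

  IsWalk-cons : ∀ x y xs → T (treeAdj x y) → head xs ≡ just y → IsWalk tree xs → IsWalk tree (x ∷ xs)
  IsWalk-cons x y [] a () w
  IsWalk-cons x y (z ∷ zs) a refl w = a , w

  last-cons : ∀ (x y : Fin n) xs → head xs ≡ just y → last (x ∷ xs) ≡ last xs
  last-cons x y [] ()
  last-cons x y (z ∷ zs) _ = refl

  IsWalk-snoc : ∀ xs y z → IsWalk tree xs → last xs ≡ just y → T (treeAdj y z) → IsWalk tree (xs ∷ʳ z)
  IsWalk-snoc [] y z () l a
  IsWalk-snoc (x ∷ []) y z w refl a = a , tt
  IsWalk-snoc (x ∷ x' ∷ xs) y z (axx , w) l a = axx , IsWalk-snoc (x' ∷ xs) y z w l a

  last-snoc : ∀ (xs : List (Fin n)) z → last (xs ∷ʳ z) ≡ just z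
  last-snoc [] z = refl
  last-snoc (x ∷ []) z = refl
  last-snoc (x ∷ x' ∷ xs) z = last-snoc (x' ∷ xs) z

  head-snoc : ∀ (xs : List (Fin n)) u z → head xs ≡ just u → head (xs ∷ʳ z) ≡ just u
  head-snoc [] u z ()
  head-snoc (x ∷ xs) u z h = h

  pathToRoot : ℕ → Fin n → List (Fin n)
  pathToRoot zero v = v ∷ []
  pathToRoot (suc k) v with T-or-T-not (eqF v a0)
  ... | inj₁ _ = v ∷ []
  ... | inj₂ _ = v ∷ pathToRoot k (p v)

  pathToRoot-walk : ∀ k v → ρ v < k → IsWalk tree (pathToRoot k v) × head (pathToRoot k v) ≡ just v × last (pathToRoot k v) ≡ just a0
  pathToRoot-walk zero v ()
  pathToRoot-walk (suc k) v lt with T-or-T-not (eqF v a0)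
  ... | inj₁ e = tt , refl , cong just (eqF-sound e)
  ... | inj₂ ne' =
    let ne : v ≢ a0
        ne e = T-not⇒¬T ne' (subst (λ z → T (eqF v z)) e (eqF-refl v))
        (w , h , l) = pathToRoot-walk k (p v) (≤-trans (proj₂ (proj₂ (alternating v ne))) (s≤s⁻¹ lt))
    in IsWalk-cons v (p v) (pathToRoot k (p v)) (T∨₁ {parentEdge v (p v)} (parentEdge-intro v (p v) ne refl)) h w , refl ,
       trans (last-cons v (p v) (pathToRoot k (p v)) h) l

  extendFromRoot : ℕ → List (Fin n) → Fin n → List (Fin n)
  extendFromRoot zero W v = W
  extendFromRoot (suc k) W v with T-or-T-not (eqF v a0)
  ... | inj₁ _ = W
  ... | inj₂ _ = extendFromRoot k W (p v) ∷ʳ v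

  extendFromRoot-walk : ∀ k W u v → IsWalk tree W → head W ≡ just u → last W ≡ just a0 → ρ v < k →
             IsWalk tree (extendFromRoot k W v) × head (extendFromRoot k W v) ≡ just u × last (extendFromRoot k W v) ≡ just v
  extendFromRoot-walk zero W u v w h l ()
  extendFromRoot-walk (suc k) W u v w h l lt with T-or-T-not (eqF v a0)
  ... | inj₁ e = w , h , trans l (cong just (sym (eqF-sound e)))
  ... | inj₂ ne' =
    let ne : v ≢ a0
        ne e = T-not⇒¬T ne' (subst (λ z → T (eqF v z)) e (eqF-refl v))
        (w' , h' , l') = extendFromRoot-walk k W u (p v) w h l (≤-trans (proj₂ (proj₂ (alternating v ne))) (s≤s⁻¹ lt))
    in IsWalk-snoc (extendFromRoot k W (p v)) (p v) v w' l' (T∨₂ {parentEdge (p v) v} (parentEdge-intro v (p v) ne refl)) ,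
       head-snoc (extendFromRoot k W (p v)) u v h' , last-snoc (extendFromRoot k W (p v)) v

  tree-connected : Connected tree
  tree-connected u v =
    let (w , h , l) = pathToRoot-walk (suc (ρ u)) u ≤-refl
        W = pathToRoot (suc (ρ u)) u
    in extendFromRoot (suc (ρ v)) W v , extendFromRoot-walk (suc (ρ v)) W u v w h l ≤-refl

  NonBacktracking : List (Fin n) → Set
  NonBacktracking (a ∷ b ∷ c ∷ rest) = a ≢ c × NonBacktracking (b ∷ c ∷ rest)
  NonBacktracking _ = ⊤

  penult : Fin n → Fin n → List (Fin n) → Fin n
  penult a b [] = a
  penult a b (c ∷ rest) = penult b c rest

  descending : ∀ a b rest → IsWalk tree (a ∷ b ∷ rest) → NonBacktracking (a ∷ b ∷ rest) → b ≢ a0 → p b ≡ a → ρ a < ρ (lastOr b rest)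
  descending a b [] w nb bne pb = subst (λ z → ρ z < ρ b) pb (proj₂ (proj₂ (alternating b bne)))
  descending a b (c ∷ rest) (aab , abc , w) (anc , nb) bne pb with treeAdj-elim b c abc
  ... | inj₁ (_ , pbc) = ⊥-elim (anc (trans (sym pb) pbc))
  ... | inj₂ (cne , pcb) = <-trans (subst (λ z → ρ z < ρ b) pb (proj₂ (proj₂ (alternating b bne)))) (descending b c rest (abc , w) nb cne pcb)

  -- Each vertex has one parent, so a non-backtracking walk that steps down to a child keeps stepping
  -- down: it climbs towards the root and then descends, and so cannot return to its start.
  ascending-or-descending : ∀ a b rest → IsWalk tree (a ∷ b ∷ rest) → NonBacktracking (a ∷ b ∷ rest) →
          ρ (lastOr b rest) < ρ a ⊎ (lastOr b rest ≢ a0 × p (lastOr b rest) ≡ penult a b rest)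
  ascending-or-descending a b [] (aab , _) nb with treeAdj-elim a b aab
  ... | inj₁ (ane , pab) = inj₁ (subst (λ z → ρ z < ρ a) pab (proj₂ (proj₂ (alternating a ane))))
  ... | inj₂ (bne , pba) = inj₂ (bne , pba)
  ascending-or-descending a b (c ∷ rest) (aab , w) (anc , nb) with ascending-or-descending b c rest w nb
  ... | inj₂ r = inj₂ r
  ... | inj₁ lt with treeAdj-elim a b aab
  ...   | inj₁ (ane , pab) = inj₁ (<-trans lt (subst (λ z → ρ z < ρ a) pab (proj₂ (proj₂ (alternating a ane)))))
  ...   | inj₂ (bne , pba) with treeAdj-elim b c (proj₁ w)
  ...     | inj₁ (_ , pbc) = ⊥-elim (anc (trans (sym pba) pbc))
  ...     | inj₂ (cne , pcb) = ⊥-elim (<-asym lt (descending b c rest w nb cne pcb))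

  unique⇒nonBacktracking : ∀ xs → Unique xs → NonBacktracking xs
  unique⇒nonBacktracking [] _ = tt
  unique⇒nonBacktracking (a ∷ []) _ = tt
  unique⇒nonBacktracking (a ∷ b ∷ []) _ = tt
  unique⇒nonBacktracking (a ∷ b ∷ c ∷ rest) ((_ ∷ anc ∷ _) ∷ u) = anc , unique⇒nonBacktracking (b ∷ c ∷ rest) u

  penult∈ : ∀ a b rest → penult a b rest ∈ (a ∷ b ∷ rest)
  penult∈ a b [] = here refl
  penult∈ a b (c ∷ rest) = there (penult∈ b c rest)

  lastOr∈ : ∀ (b : Fin n) rest → lastOr b rest ∈ (b ∷ rest)
  lastOr∈ b [] = here refl
  lastOr∈ b (c ∷ rest) = there (lastOr∈ c rest)

  tree-acyclic : ¬ HasCycle tree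
  tree-acyclic (x0 ∷ x1 ∷ c ∷ rest , x , y , len , ((w , hx , ly) , u) , ayx) =
    let L = lastOr c rest
        eL : L ≡ y
        eL = just-injective (trans (sym (last≡ x0 (x1 ∷ c ∷ rest))) ly)
        ex : x0 ≡ x
        ex = just-injective hx
        aL : T (treeAdj L x0)
        aL = subst₂ (λ s t → T (treeAdj s t)) (sym eL) (sym ex) ayx
        u0 : All (x0 ≢_) (x1 ∷ c ∷ rest)
        u0 = AllPairs-head u
        u1 : All (x1 ≢_) (c ∷ rest)
        u1 = AllPairs-head (AllPairs-tail u)
    in fin aL u0 u1
    where
      AllPairs-head : ∀ {z zs} → Unique (z ∷ zs) → All (z ≢_) zs
      AllPairs-head (h ∷ _) = h
      AllPairs-tail : ∀ {z zs} → Unique (z ∷ zs) → Unique zs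
      AllPairs-tail (_ ∷ t) = t
      fin : T (treeAdj (lastOr c rest) x0) → All (x0 ≢_) (x1 ∷ c ∷ rest) → All (x1 ≢_) (c ∷ rest) → ⊥
      fin aL u0 u1 with treeAdj-elim (lastOr c rest) x0 aL
      ... | inj₁ (Lne , pL) with ascending-or-descending x0 x1 (c ∷ rest) w (unique⇒nonBacktracking _ u)
      ...   | inj₁ lt = <-asym lt (subst (λ z → ρ z < ρ (lastOr c rest)) pL (proj₂ (proj₂ (alternating _ Lne))))
      ...   | inj₂ (_ , pe) = All.lookup u0 (penult∈ x1 c rest) (trans (sym pL) pe)
      fin aL u0 u1 | inj₂ (x0ne , px0) = <-irrefl refl (descending (lastOr c rest) x0 (x1 ∷ c ∷ rest) (aL , w) (Lnx1 , unique⇒nonBacktracking _ u) x0ne px0)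
        where Lnx1 : lastOr c rest ≢ x1
              Lnx1 e = All.lookup u1 (lastOr∈ c rest) (sym e)
  tree-acyclic (_ ∷ _ ∷ [] , _ , _ , s≤s (s≤s ()) , _)
  tree-acyclic (_ ∷ [] , _ , _ , s≤s () , _)
  tree-acyclic ([] , _ , _ , () , _)

  evenSpanningTree : Σ (Graph n) λ T' → SpanningTree G T' × EvenTree T'
  evenSpanningTree = tree , (tree⊆G , tree-connected , tree-acyclic) , tree-even

-- Regular non-bipartite graphs

module _ {n : ℕ} (G : Graph n) where

  IndependentIn : (Fin n → Bool) → Set
  IndependentIn B = ∀ u v → T (B u) → T (B v) → ¬ Adj G u v

  crossBigraph : (Fin n → Bool) → Bigraph n
  crossBigraph B = bigraph (λ v → not (B v)) B (adj G)

  crossBigraph-disjoint : ∀ B → Disjoint (crossBigraph B)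
  crossBigraph-disjoint B v = T-not⇒¬T

  crossBigraph-covers : ∀ B v → T (inV (crossBigraph B) v)
  crossBigraph-covers B v with B v
  ... | true = tt
  ... | false = tt

  module GreedyIndependentSet (conn : Connected G) (a0 : Fin n) where

    IndependentOn : (S B : Fin n → Bool) → Set
    IndependentOn S B = ∀ u v → T (S u) → T (S v) → T (B u) → T (B v) → ¬ Adj G u v

    RespectsCrossEdgesOn : (S B C : Fin n → Bool) → Set
    RespectsCrossEdgesOn S B C = ∀ a b → T (S a) → T (S b) → ¬ T (B a) → T (B b) → Adj G a b → C a ≡ C b

    CrossConnectedOn : (S B : Fin n → Bool) → Set
    CrossConnectedOn S B = ∀ C → RespectsCrossEdgesOn S B C → ∀ v → T (S v) → C v ≡ C a0

    Result : Set
    Result = Σ (Fin n → Bool) λ B → B a0 ≡ false × IndependentOn (λ _ → true) B × CrossConnectedOn (λ _ → true) B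

    leaves : (Fin n → Bool) → Fin n → Fin n → Bool
    leaves S u v = S u ∧ (not (S v) ∧ adj G u v)

    no-leaving-edge⇒all : ∀ S → T (S a0) → (∀ u v → ¬ T (leaves S u v)) → ∀ v → T (S v)
    no-leaving-edge⇒all S Sa0 closed v = subst T (sym (trans (connected⇒constant G conn S respects v a0) (T⇒≡true Sa0))) tt
      where
        respects : RespectsEdges G S
        respects u v e with S u in eu | S v in ev
        ... | true | true = refl
        ... | false | false = refl
        ... | true | false = ⊥-elim (closed u v (T∧ {S u} (subst T (sym eu) tt) (T∧ {not (S v)} (subst T (cong not (sym ev)) tt) e)))
        ... | false | true = ⊥-elim (closed v u (T∧ {S v} (subst T (sym ev) tt) (T∧ {not (S u)} (subst T (cong not (sym eu)) tt) (subst T (gsym G u v) e))))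

    module Extend (S B : Fin n → Bool) (Sa0 : T (S a0)) (Ba0 : B a0 ≡ false)
                  (ind : IndependentOn S B) (cs : CrossConnectedOn S B)
                  (u v : Fin n) (Su : T (S u)) (nSv : ¬ T (S v)) (auv : Adj G u v) where

      noBNeighbour : Bool
      noBNeighbour = not (any (λ x → S x ∧ (B x ∧ adj G x v)))

      S' B' : Fin n → Bool
      S' w = S w ∨ eqF w v
      B' w = if eqF w v then noBNeighbour else B w

      S≢v : ∀ w → T (S w) → w ≢ v
      S≢v w Sw e = nSv (subst (λ z → T (S z)) e Sw)

      B'-old : ∀ w → w ≢ v → B' w ≡ B w
      B'-old w ne = if-f {b = eqF w v} (λ t → ne (eqF-sound t))

      B'-new : B' v ≡ noBNeighbour
      B'-new = if-t {b = eqF v v} (eqF-refl v)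

      S'-elim : ∀ w → T (S' w) → T (S w) ⊎ w ≡ v
      S'-elim w t = [ inj₁ , (λ e → inj₂ (eqF-sound e)) ]′ (T∨-elim {S w} t)

      S'-new : T (S' v)
      S'-new = T∨₂ {S v} (eqF-refl v)

      S⊆S' : ∀ w → T (S w) → T (S' w)
      S⊆S' w = T∨₁ {S w}

      unexplored-< : count (λ w → not (S' w)) < count (λ w → not (S w))
      unexplored-< = count-mono-< (λ w → not (S' w)) (λ w → not (S w)) (λ w t → ¬T⇒T-not (λ s → T-not⇒¬T t (S⊆S' w s)))
                       v (¬T⇒T-not nSv) (λ t → T-not⇒¬T t S'-new)

      B'a0 : B' a0 ≡ false
      B'a0 = trans (B'-old a0 (S≢v a0 Sa0)) Ba0

      independent : IndependentOn S' B'
      independent x y sx sy bx by axy = cases (S'-elim x sx) (S'-elim y sy)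
        where
          new : ∀ z → T (S z) → T (B' v) → T (B' z) → Adj G z v → ⊥
          new z sz bv bz azv = T-not⇒¬T (subst T B'-new bv)
            (any-intro (λ x → S x ∧ (B x ∧ adj G x v)) z (T∧ {S z} sz (T∧ {B z} (subst T (B'-old z (S≢v z sz)) bz) azv)))
          cases : T (S x) ⊎ x ≡ v → T (S y) ⊎ y ≡ v → ⊥
          cases (inj₁ sx') (inj₁ sy') = ind x y sx' sy' (subst T (B'-old x (S≢v x sx')) bx) (subst T (B'-old y (S≢v y sy')) by) axy
          cases (inj₂ refl) (inj₁ sy') = new y sy' bx by (subst T (gsym G x y) axy)
          cases (inj₁ sx') (inj₂ refl) = new x sx' by bx axy
          cases (inj₂ refl) (inj₂ refl) = subst T (loopless G x) axy

      crossConnected : CrossConnectedOn S' B'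
      crossConnected C r w sw = cases (S'-elim w sw)
        where
          rS : RespectsCrossEdgesOn S B C
          rS a b sa sb na bb e = r a b (S⊆S' a sa) (S⊆S' b sb) (λ t → na (subst T (B'-old a (S≢v a sa)) t)) (subst T (sym (B'-old b (S≢v b sb))) bb) e
          joinedViaU : T noBNeighbour → C v ≡ C a0
          joinedViaU t = trans (sym (r u v (S⊆S' u Su) S'-new (λ b' → ¬Bu (subst T (B'-old u (S≢v u Su)) b')) (subst T (sym B'-new) t) auv)) (cs C rS u Su)
            where ¬Bu : ¬ T (B u)
                  ¬Bu bu = T-not⇒¬T t (any-intro (λ x → S x ∧ (B x ∧ adj G x v)) u (T∧ {S u} Su (T∧ {B u} bu auv)))
          joinedViaB : T (not noBNeighbour) → C v ≡ C a0
          joinedViaB f =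
            let (x , tx) = any-elim _ (subst T (not-involutive _) f)
                Sx = T∧₁ {S x} tx
                Bx = T∧₁ {B x} (T∧₂ {S x} tx)
                axv = T∧₂ {B x} (T∧₂ {S x} tx)
            in trans (r v x S'-new (S⊆S' x Sx) (λ b' → T-not⇒¬T f (subst T B'-new b')) (subst T (sym (B'-old x (S≢v x Sx))) Bx) (subst T (gsym G x v) axv))
                     (cs C rS x Sx)
          cases : T (S w) ⊎ w ≡ v → C w ≡ C a0
          cases (inj₁ s) = cs C rS w s
          cases (inj₂ refl) = [ joinedViaU , joinedViaB ]′ (T-or-T-not noBNeighbour)

    -- A new vertex v joins B exactly when it has no neighbour in B yet, so it is attached by a cross edge:
    -- to u if it joins B, and to that neighbour otherwise.
    greedy : ∀ fuel (S B : Fin n → Bool) → count (λ w → not (S w)) < fuel → T (S a0) → B a0 ≡ false →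
             IndependentOn S B → CrossConnectedOn S B → Result
    greedy zero S B () Sa0 Ba0 ind cs
    greedy (suc fuel) S B lt Sa0 Ba0 ind cs with T-or-T-not (any (λ u → any (leaves S u)))
    ... | inj₂ none =
      B , Ba0 , (λ u v _ _ → ind u v (everywhere u) (everywhere v)) , (λ C r v _ → cs C (λ a b _ _ → r a b tt tt) v (everywhere v))
      where everywhere : ∀ v → T (S v)
            everywhere = no-leaving-edge⇒all S Sa0 (λ u v t → T-not⇒¬T none (any-intro _ u (any-intro (leaves S u) v t)))
    ... | inj₁ some =
      let (u , tu) = any-elim _ some
          (v , tv) = any-elim _ tu
          open Extend S B Sa0 Ba0 ind cs u v (T∧₁ {S u} tv) (T-not⇒¬T (T∧₁ {not (S v)} (T∧₂ {S u} tv))) (T∧₂ {not (S v)} (T∧₂ {S u} tv))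
      in greedy fuel S' B' (≤-trans unexplored-< (s≤s⁻¹ lt)) (S⊆S' a0 Sa0) B'a0 independent crossConnected

    result : Result
    result = greedy (suc (count (λ w → not (eqF w a0)))) (λ w → eqF w a0) (λ _ → false) ≤-refl (eqF-refl a0) refl
                    (λ u v _ _ ())
                    (λ C r v sv → cong C (eqF-sound sv))

  independentSet : Connected G → (a0 : Fin n) →
    Σ (Fin n → Bool) λ B → B a0 ≡ false × IndependentIn B × IsConnected (crossBigraph B)
  independentSet conn a0 with GreedyIndependentSet.result conn a0
  ... | B , Ba0 , ind , cs = B , Ba0 , (λ u v → ind u v tt tt) , connected
    where
      connected : IsConnected (crossBigraph B)
      connected C resp u v _ _ = trans (toRoot u) (sym (toRoot v))
        where toRoot : ∀ w → C w ≡ C a0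
              toRoot w = cs C (λ a b _ _ na bb e → resp a b (¬T⇒T-not na) bb e) w tt

module SmallNeighbourhood {n : ℕ} {G : Graph n} {r : ℕ} (reg : Regular r G) (conn : Connected G)
  {B : Fin n → Bool} (indep : IndependentIn G B)
  (X : Fin n → Bool) (X⊆B : SubsetOfB (crossBigraph G B) X) (x : Fin n) (Xx : T (X x))
  (small : count (nbhd (crossBigraph G B) X) ≤ count X) where

  N : Fin n → Bool
  N = nbhd (crossBigraph G B) X

  deg : ∀ v → count (adj G v) ≡ r
  deg v = trans (sym (degree≡count G v)) (reg v)

  neighbour∈N : ∀ b a → T (X b) → Adj G b a → T (N a)
  neighbour∈N b a xb e =
    T∧ {not (B a)} (¬T⇒T-not (λ ba → indep b a (X⊆B b xb) ba e)) (any-intro (λ b' → X b' ∧ adj G a b') b (T∧ {X b} xb (subst T (gsym G b a) e)))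

  F : Fin n → Fin n → Bool
  F a b = N a ∧ (X b ∧ adj G a b)

  edges-at-X : ∀ b → count (λ a → F a b) ≡ (if X b then r else 0)
  edges-at-X b with T-or-T-not (X b)
  ... | inj₁ xb = trans (count-cong _ _ (λ a → T-ext (λ t → subst T (gsym G a b) (T∧₂ {X b} (T∧₂ {N a} t)))
                                                     (λ t → T∧ {N a} (neighbour∈N b a xb t) (T∧ {X b} xb (subst T (gsym G b a) t)))))
                        (trans (deg b) (sym (if-t {b = X b} xb)))
  ... | inj₂ nxb = trans (count-none _ (λ a t → T-not⇒¬T nxb (T∧₁ {X b} (T∧₂ {N a} t)))) (sym (if-f {b = X b} (T-not⇒¬T nxb)))

  edges-at-N : ∀ a → count (λ b → F a b) ≤ (if N a then r else 0)
  edges-at-N a with T-or-T-not (N a)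
  ... | inj₁ na = subst (count (λ b → F a b) ≤_) (trans (deg a) (sym (if-t {b = N a} na))) (count-mono _ _ (λ b t → T∧₂ {X b} (T∧₂ {N a} t)))
  ... | inj₂ nna = subst (_≤ (if N a then r else 0)) (sym (count-none (λ b → F a b) (λ b t → T-not⇒¬T nna (T∧₁ {N a} t)))) z≤n

  edges-between : sum (λ a → count (λ b → F a b)) ≡ r * count X
  edges-between = begin
    sum (λ a → count (λ b → F a b))                 ≡⟨ sum-cong _ _ (λ a → count≡sum-indicator (λ b → F a b)) ⟩
    sum (λ a → sum (λ b → if F a b then 1 else 0))  ≡⟨ sum-swap (λ a b → if F a b then 1 else 0) ⟩
    sum (λ b → sum (λ a → if F a b then 1 else 0))  ≡⟨ sum-cong _ _ (λ b → sym (count≡sum-indicator (λ a → F a b))) ⟩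
    sum (λ b → count (λ a → F a b))                 ≡⟨ sum-cong _ _ edges-at-X ⟩
    sum (λ b → if X b then r else 0)                ≡⟨ sum-indicator-scaled X r ⟩
    r * count X                                     ∎
    where open ≡-Reasoning

  -- Equality must hold in the double count r|X| ≤ r|N(X)| ≤ r|X|, so each vertex of N(X) has all its neighbours in X.
  N-closed : ∀ a → T (N a) → ∀ c → Adj G a c → T (X c)
  N-closed a na c e with T-or-T-not (X c)
  ... | inj₁ xc = xc
  ... | inj₂ nxc = ⊥-elim (<-irrefl refl (begin-strict
        r * count X                         ≡⟨ edges-between ⟨
        sum (λ a → count (λ b → F a b))     <⟨ sum-mono-< _ _ edges-at-N a fewer ⟩
        sum (λ a → if N a then r else 0)    ≡⟨ sum-indicator-scaled N r ⟩
        r * count N                         ≤⟨ *-monoʳ-≤ r small ⟩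
        r * count X                         ∎))
    where
      open ≤-Reasoning
      fewer : count (λ b → F a b) < (if N a then r else 0)
      fewer = subst (count (λ b → F a b) <_) (trans (deg a) (sym (if-t {b = N a} na)))
                 (count-mono-< _ _ (λ b t → T∧₂ {X b} (T∧₂ {N a} t)) c e (λ t → T-not⇒¬T nxc (T∧₁ {X c} (T∧₂ {N a} t))))

  X∪N : Fin n → Bool
  X∪N v = X v ∨ N v

  X∪N-closed : ∀ u w → Adj G u w → T (X∪N u) → T (X∪N w)
  X∪N-closed u w e t with T∨-elim {X u} t
  ... | inj₁ xu = T∨₂ {X w} (neighbour∈N u w xu e)
  ... | inj₂ nu = T∨₁ {X w} (N-closed u nu w e)

  X∪N-everything : ∀ v → T (X∪N v)
  X∪N-everything v = subst T (sym (trans (connected⇒constant G conn X∪N respects v x) (T⇒≡true (T∨₁ {X x} Xx)))) tt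
    where respects : RespectsEdges G X∪N
          respects u w e = T-ext (X∪N-closed u w e) (X∪N-closed w u (subst T (gsym G u w) e))

  bipartite : Bipartite G
  bipartite = X , proper
    where
      proper : ∀ u w → Adj G u w → X u ≢ X w
      proper u w e eq with T-or-T-not (X u)
      ... | inj₁ xu = indep u w (X⊆B u xu) (X⊆B w (subst T eq xu)) e
      ... | inj₂ nxu with T∨-elim {X u} (X∪N-everything u)
      ...   | inj₁ xu = T-not⇒¬T nxu xu
      ...   | inj₂ nu = T-not⇒¬T (subst T (cong not eq) nxu) (N-closed u nu w e)

regular-independent⇒surplus : ∀ {n} {G : Graph n} {r} → Regular r G → ¬ Bipartite G → Connected G →
  ∀ {B} → IndependentIn G B → Surplus (crossBigraph G B)
regular-independent⇒surplus {G = G} reg nbp conn {B} indep X X⊆B x Xx with suc (count X) ≤? count (nbhd (crossBigraph G B) X)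
... | yes p = p
... | no np = ⊥-elim (nbp (SmallNeighbourhood.bipartite reg conn indep X X⊆B x Xx (s≤s⁻¹ (≰⇒> np))))

parentTree⇒evenSpanningTree : ∀ {n} (G : Graph n) (B : Fin n → Bool) (a0 : Fin n) → B a0 ≡ false →
  ParentTree (crossBigraph G B) a0 → Σ (Graph n) λ T' → SpanningTree G T' × EvenTree T'
parentTree⇒evenSpanningTree {n} G B a0 Ba0 tree = TreeFromParents.evenSpanningTree G B a0 Ba0 p ρ alternating hasChild
  where
    open ParentTree tree
    alternating : ∀ v → v ≢ a0 → Adj G v (p v) × B (p v) ≡ not (B v) × ρ (p v) < ρ v
    alternating v v≢a0 = fromStep v (step v (crossBigraph-covers G B v) v≢a0)
      where
        fromStep : ∀ v → ParentStep (crossBigraph G B) p ρ v → Adj G v (p v) × B (p v) ≡ not (B v) × ρ (p v) < ρ v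
        fromStep v (parentStep fromA fromB p<) with B v
        ... | false = let (Bp , e) = fromA tt in e , T⇒≡true Bp , p<
        ... | true = let (¬Bp , e) = fromB tt in subst T (gsym G (p v) v) e , ¬T⇒≡false (T-not⇒¬T ¬Bp) , p<
    hasChild : ∀ b → B b ≡ true → Σ (Fin n) λ c → c ≢ a0 × p c ≡ b
    hasChild b Bb with child b (subst T (sym Bb) tt)
    ... | c , _ , c≢a0 , pc = c , c≢a0 , pc

theorem4 : (r : ℕ) → Odd r → (n : ℕ) → (G : Graph n) → Regular r G →
  ¬ Bipartite G → Connected G →
  Σ (Graph n) λ T' → SpanningTree G T' × EvenTree T'
theorem4 r _ zero G reg nbp conn = ⊥-elim (nbp ((λ ()) , (λ ())))
theorem4 r _ (suc m) G reg nbp conn =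
  let (B , Ba0 , indep , crossConnected) = independentSet G conn zero
      H = crossBigraph G B
      tree = surplus⇒parentTree H (crossBigraph-disjoint G B) crossConnected (regular-independent⇒surplus reg nbp conn indep)
                                zero (subst T (cong not (sym Ba0)) tt)
  in parentTree⇒evenSpanningTree G B zero Ba0 tree
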